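{- For every integer $n\ge 6$ and every integer $t$ with $1\le t\le n-3$, $$\mathrm{wdim}_{2n-2t-1}(K_n\times K_n)=n^2-tn-\left\lfloor\frac{n}{t+1}\right\rfloor.$$
   Context: $K_n\times K_n$ is the direct product of two complete graphs: vertex set $[n]\times[n]$ with $[n]=\{1,\dots,n\}$, where $(i,j)$ and $(i',j')$ are adjacent iff $i\ne i'$ and $j\ne j'$. With $d$ the shortest-path distance, for $S\subseteq V$ and vertices $x,y,z$: $\Delta_z(x,y)=|d(x,z)-d(y,z)|$ and $\Delta_S(x,y)=\sum_{z\in S}\Delta_z(x,y)$. A set $S$ of vertices is a weak $k$-resolving set if $\Delta_S(x,y)\ge k$ for all distinct vertices $x,y$. The weak $k$-metric dimension $\mathrm{wdim}_k(G)$ is the minimum cardinality of a weak $k$-resolving set of $G$. -}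

module Defs where

open import Data.Nat using (ℕ; zero; suc; _+_; _∸_; _≤_)
open import Data.Bool using (Bool; true; false; _∧_; _∨_; not; if_then_else_)
open import Data.Product using (_×_; _,_; Σ; ∃)
open import Data.List using (List; []; _∷_; map; concatMap; length; filter)
open import Data.Bool.ListAction using (any)
open import Data.Nat.ListAction using (sum)
open import Data.Fin using (Fin)
open import Data.Fin.Properties using (_≟_)
open import Data.List using (allFin)
open import Relation.Nullary.Decidable using (⌊_⌋)
open import Relation.Binary.PropositionalEquality using (_≡_)

record FinGraph : Set₁ where
  field
    V     : Set
    verts : List V
    eqV   : V → V → Bool
    adj   : V → V → Bool

module _ (G : FinGraph) where
  open FinGraph G

  reach : ℕ → V → V → Bool
  reach zero    x y = eqV x y
  reach (suc k) x y = reach k x y ∨ any (λ z → reach k x z ∧ adj z y) verts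

  -- least k ≤ bound with reach k x y (bound returned if none: only happens
  -- for disconnected pairs, since shortest paths have length < |V|)
  leastFrom : ℕ → ℕ → V → V → ℕ
  leastFrom k zero      x y = k
  leastFrom k (suc fuel) x y =
    if reach k x y then k else leastFrom (suc k) fuel x y

  dist : V → V → ℕ
  dist x y = leastFrom 0 (length verts) x y

  absDiff : ℕ → ℕ → ℕ
  absDiff a b = (a ∸ b) + (b ∸ a)

  Δ : V → V → V → ℕ
  Δ z x y = absDiff (dist x z) (dist y z)

  card : (V → Bool) → ℕ
  card S = length (filter (λ z → S z Data.Bool.≟ true) verts)

  ΔS : (V → Bool) → V → V → ℕ
  ΔS S x y = sum (map (λ z → if S z then Δ z x y else 0) verts)

  IsWeakResolving : ℕ → (V → Bool) → Set
  IsWeakResolving k S = ∀ x y → eqV x y ≡ false → k ≤ ΔS S x y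

  WdimIs : ℕ → ℕ → Set
  WdimIs k m =
    Σ (V → Bool) (λ S → IsWeakResolving k S × card S ≡ m)
    × (∀ S → IsWeakResolving k S → m ≤ card S)

KnxKn : ℕ → FinGraph
KnxKn n = record
  { V     = Fin n × Fin n
  ; verts = concatMap (λ i → map (λ j → (i , j)) (allFin n)) (allFin n)
  ; eqV   = λ { (i , j) (i' , j') → ⌊ i ≟ i' ⌋ ∧ ⌊ j ≟ j' ⌋ }
  ; adj   = λ { (i , j) (i' , j') → not ⌊ i ≟ i' ⌋ ∧ not ⌊ j ≟ j' ⌋ }
  }

-- Distances in K_n × K_n are 0, 2 (same row or same column) and 1 (otherwise), so Δ_S is a
-- combination of row and column counts of S: for two cells of a row it is the number of
-- elements of S in their two columns plus those at the two cells, symmetrically for columns,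
-- and for two adjacent cells it is the S-count of their two rows and two columns minus a
-- contribution of the four cells they span. Put p = n − t, so that 2n − 2t − 1 = 2p − 1.
--
-- Lower bound: if every column holds at least p − 1 elements of S, two columns holding exactly
-- p − 1 cannot both miss a cell of the same row, and each misses t + 1 cells, so there are at
-- most ⌊n/(t+1)⌋ of them. A column with at most p − 2 elements forces all other columns to be
-- so full that |S| ≥ pn − 2, or even pn − 1 when 2(t + 1) > n, while ⌊n/(t+1)⌋ is at least 2,
-- respectively 1.
--
-- Upper bound: the holes of S (the cells outside it) are the cyclic band {(a , a + k mod n) : k < t}
-- together with the cells (a , a + t) for a = q(t + 1), q < ⌊n/(t+1)⌋. Every row and column then
-- has t or t + 1 holes, and the heavier rows and columns lie in disjoint blocks of width t + 1,
-- which keeps all pairs (2p − 1)-resolved.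

module Submission where

open import Defs
open import Data.Bool using (Bool; true; false; not; _∧_; _∨_; if_then_else_)
open import Data.Bool.ListAction using (any)
open import Data.Bool.Properties using (∨-zeroʳ)
import Data.Bool as Bool
open import Data.Empty using (⊥; ⊥-elim)
open import Data.Fin using (Fin; zero; suc; toℕ; punchIn)
open import Data.Fin.Properties using (_≟_; toℕ<n; toℕ-injective; suc-injective; punchInᵢ≢i; any?)
open import Data.List using (List; []; _∷_; map; concatMap; filter; length; tabulate; allFin; _++_)
open import Data.List.Membership.Propositional using (_∈_; lose)
open import Data.List.Membership.Propositional.Properties using (∈-allFin; ∈-map⁺; ∈-concatMap⁺)
open import Data.List.Properties using (map-++; map-∘)
open import Data.List.Relation.Unary.Any using (here; there)
open import Data.Nat using (ℕ; zero; suc; _+_; _*_; _∸_; _⊓_; _≤_; _<_; _/_; z≤n; s≤s; z<s; _≤?_; _<?_; NonZero)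
open import Data.Nat.DivMod using (m*n/n≡m; m/n*n≤m; /-monoˡ-≤)
open import Data.Nat.ListAction using (sum)
open import Data.Nat.Tactic.RingSolver using (solve-∀)
open import Data.Nat.ListAction.Properties using (sum-++)
open import Data.Nat.Properties hiding (_≟_; suc-injective)
import Data.Nat.Properties as ℕ
open import Data.Product using (_×_; _,_; Σ; ∃; proj₁; proj₂; swap)
open import Data.Sum using (_⊎_; inj₁; inj₂)
open import Function using (_∘_; _⇔_; mk⇔; case_of_; Equivalence)
open import Relation.Nullary using (¬_; Dec; yes; no; does; _×-dec_; _⊎-dec_)
open import Relation.Nullary.Decidable using (⌊_⌋; dec-true; dec-false; ⌊⌋-map′; isYes≗does; does-⇔)
open import Relation.Binary.PropositionalEquality
open import Relation.Binary using (tri<; tri≈; tri>)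

open import Algebra.Properties.CommutativeSemigroup +-commutativeSemigroup using (x∙yz≈y∙xz)
open import Algebra.Properties.Semiring.Sum +-*-semiring
  using (sum-syntax; sum-cong-≗; sum-replicate-zero; sum-remove; ∑-distrib-+; ∑-comm; *-distribˡ-sum; *-distribʳ-sum)
  renaming (sum to ∑)

χ : Bool → ℕ
χ true  = 1
χ false = 0

χ≤1 : ∀ b → χ b ≤ 1
χ≤1 true  = ≤-refl
χ≤1 false = z≤n

χ-not : ∀ b → χ (not b) + χ b ≡ 1
χ-not true  = refl
χ-not false = refl

χ-∧ : ∀ b c → χ (b ∧ c) ≡ χ b * χ c
χ-∧ true  c = sym (+-identityʳ (χ c))
χ-∧ false c = refl

χ-∨ : ∀ b c → (b ∧ c) ≡ false → χ (b ∨ c) ≡ χ b + χ c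
χ-∨ true  false _ = refl
χ-∨ false c     _ = refl

χ-not-all : ∀ w x y z → w ∧ x ∧ y ∧ z ≡ false → χ w + χ x + χ y + χ z ≤ 3
χ-not-all false x     y     z     _ = +-mono-≤ (+-mono-≤ (χ≤1 x) (χ≤1 y)) (χ≤1 z)
χ-not-all true  false y     z     _ = s≤s (+-mono-≤ (χ≤1 y) (χ≤1 z))
χ-not-all true  true  false z     _ = s≤s (s≤s (χ≤1 z))
χ-not-all true  true  true  false _ = ≤-refl

δ : ∀ {n} → Fin n → Fin n → ℕ
δ i a = χ ⌊ i ≟ a ⌋

δ-suc : ∀ {n} (i a : Fin n) → δ (suc i) (suc a) ≡ δ i a
δ-suc i a = cong χ (⌊⌋-map′ _ _ (i ≟ a))

∑-const : ∀ n c → ∑[ i < n ] c ≡ n * c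
∑-const zero    c = refl
∑-const (suc n) c = cong (c +_) (∑-const n c)

∑-one : ∀ n → ∑[ i < n ] 1 ≡ n
∑-one n = trans (∑-const n 1) (*-identityʳ n)

∑-mono-≤ : ∀ {n} {f g : Fin n → ℕ} → (∀ i → f i ≤ g i) → ∑ f ≤ ∑ g
∑-mono-≤ {zero}  f≤g = z≤n
∑-mono-≤ {suc n} f≤g = +-mono-≤ (f≤g zero) (∑-mono-≤ (f≤g ∘ suc))

∑-δ : ∀ {n} (i : Fin n) (f : Fin n → ℕ) → ∑[ a < n ] (δ i a * f a) ≡ f i
∑-δ {suc n} zero    f = trans (cong (f zero + 0 +_) (sum-replicate-zero n)) (trans (+-identityʳ _) (+-identityʳ _))
∑-δ {suc n} (suc i) f = begin
  ∑[ a < n ] (δ (suc i) (suc a) * f (suc a)) ≡⟨ sum-cong-≗ (λ a → cong (_* f (suc a)) (δ-suc i a)) ⟩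
  ∑[ a < n ] (δ i a * f (suc a))             ≡⟨ ∑-δ i (f ∘ suc) ⟩
  f (suc i)                                  ∎
  where open ≡-Reasoning

∑-δ-pair : ∀ {n} (i i′ : Fin n) (f : Fin n → ℕ) → ∑[ a < n ] ((δ i a + δ i′ a) * f a) ≡ f i + f i′
∑-δ-pair {n} i i′ f = begin
  ∑[ a < n ] ((δ i a + δ i′ a) * f a)          ≡⟨ sum-cong-≗ (λ a → *-distribʳ-+ (f a) (δ i a) (δ i′ a)) ⟩
  ∑[ a < n ] (δ i a * f a + δ i′ a * f a)      ≡⟨ ∑-distrib-+ (λ a → δ i a * f a) (λ a → δ i′ a * f a) ⟩
  ∑[ a < n ] (δ i a * f a) + ∑[ a < n ] (δ i′ a * f a) ≡⟨ cong₂ _+_ (∑-δ i f) (∑-δ i′ f) ⟩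
  f i + f i′                                   ∎
  where open ≡-Reasoning

∑-χ-not : ∀ {n} (f : Fin n → Bool) → ∑[ i < n ] χ (not (f i)) + ∑[ i < n ] χ (f i) ≡ n
∑-χ-not {n} f = begin
  ∑[ i < n ] χ (not (f i)) + ∑[ i < n ] χ (f i) ≡⟨ ∑-distrib-+ (χ ∘ not ∘ f) (χ ∘ f) ⟨
  ∑[ i < n ] (χ (not (f i)) + χ (f i))          ≡⟨ sum-cong-≗ (χ-not ∘ f) ⟩
  ∑[ i < n ] 1                                  ≡⟨ ∑-one n ⟩
  n                                             ∎
  where open ≡-Reasoning

∑-χ-false : ∀ {n} (f : Fin n → Bool) → (∀ i → f i ≡ false) → ∑[ i < n ] χ (f i) ≡ 0
∑-χ-false {n} f f≡false = trans (sum-cong-≗ (cong χ ∘ f≡false)) (sum-replicate-zero n)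

∑-χ-≤1 : ∀ {n} (f : Fin n → Bool) → (∀ i j → f i ≡ true → f j ≡ true → i ≡ j) → ∑[ i < n ] χ (f i) ≤ 1
∑-χ-≤1 {zero}  f unique = z≤n
∑-χ-≤1 {suc n} f unique with f zero in f₀
... | true  = ≤-reflexive (cong suc (∑-χ-false (f ∘ suc) rest-false))
  where
  rest-false : ∀ i → f (suc i) ≡ false
  rest-false i with f (suc i) in fᵢ
  ... | true  = case unique zero (suc i) f₀ fᵢ of λ ()
  ... | false = refl
... | false = ∑-χ-≤1 (f ∘ suc) (λ i j fi fj → suc-injective (unique (suc i) (suc j) fi fj))

∑-≥-except : ∀ {n} (f : Fin (suc n) → ℕ) (j₀ : Fin (suc n)) c →
  (∀ j → j ≢ j₀ → c ≤ f j) → f j₀ + n * c ≤ ∑ f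
∑-≥-except {n} f j₀ c c≤f = begin
  f j₀ + n * c                             ≡⟨ cong (f j₀ +_) (∑-const n c) ⟨
  f j₀ + ∑[ k < n ] c                      ≤⟨ +-monoʳ-≤ (f j₀) (∑-mono-≤ (λ k → c≤f (punchIn j₀ k) (punchInᵢ≢i j₀ k))) ⟩
  f j₀ + ∑[ k < n ] f (punchIn j₀ k)       ≡⟨ sum-remove f ⟨
  ∑ f                                      ∎
  where open ≤-Reasoning

∑-χ-toℕ≡ : ∀ {n} k → k < n → ∑[ a < n ] χ (does (toℕ a ℕ.≟ k)) ≡ 1
∑-χ-toℕ≡ {suc n} zero    _         = cong suc (sum-replicate-zero n)
∑-χ-toℕ≡ {suc n} (suc k) (s≤s k<n) = ∑-χ-toℕ≡ k k<n

∑-χ-guarded≡ : ∀ {n} {G : Set} (g? : Dec G) k → (G → k < n) →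
  ∑[ a < n ] χ (does g? ∧ does (toℕ a ℕ.≟ k)) ≡ χ (does g?)
∑-χ-guarded≡ {n} (no _)  k _   = sum-replicate-zero n
∑-χ-guarded≡     (yes g) k k<n = ∑-χ-toℕ≡ k (k<n g)

∑-χ-toℕ< : ∀ n k → ∑[ a < n ] χ (does (toℕ a <? k)) ≡ n ⊓ k
∑-χ-toℕ< zero    k       = refl
∑-χ-toℕ< (suc n) zero    = sum-replicate-zero n
∑-χ-toℕ< (suc n) (suc k) = cong suc (∑-χ-toℕ< n k)

module Counts {n : ℕ} (S : Fin n × Fin n → Bool) where

  s : Fin n → Fin n → ℕ
  s a b = χ (S (a , b))

  row col : Fin n → ℕ
  row a = ∑[ b < n ] s a b
  col b = ∑[ a < n ] s a b

  SameRowSeparated : ℕ → Set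
  SameRowSeparated p = ∀ i {j j′} → j ≢ j′ → p + p ≤ suc (col j + col j′ + (s i j + s i j′))

∑∑ : ∀ {n} → (Fin n → Fin n → ℕ) → ℕ
∑∑ {n} f = ∑[ a < n ] ∑[ b < n ] f a b

module _ {n : ℕ} where

  ∑∑-cong : ∀ {f g : Fin n → Fin n → ℕ} → (∀ a b → f a b ≡ g a b) → ∑∑ f ≡ ∑∑ g
  ∑∑-cong f≡g = sum-cong-≗ (λ a → sum-cong-≗ (f≡g a))

  ∑∑-+ : ∀ (f g : Fin n → Fin n → ℕ) → ∑∑ (λ a b → f a b + g a b) ≡ ∑∑ f + ∑∑ g
  ∑∑-+ f g = trans (sum-cong-≗ (λ a → ∑-distrib-+ (f a) (g a))) (∑-distrib-+ (∑ ∘ f) (∑ ∘ g))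

  ∑∑-δ-row : ∀ i (g : Fin n → Fin n → ℕ) → ∑∑ (λ a b → δ i a * g a b) ≡ ∑[ b < n ] g i b
  ∑∑-δ-row i g = trans (sum-cong-≗ (λ a → sym (*-distribˡ-sum (δ i a) (g a)))) (∑-δ i (λ a → ∑ (g a)))

  ∑∑-δ-rows : ∀ i i′ (g : Fin n → Fin n → ℕ) →
    ∑∑ (λ a b → (δ i a + δ i′ a) * g a b) ≡ ∑[ b < n ] g i b + ∑[ b < n ] g i′ b
  ∑∑-δ-rows i i′ g = trans (sum-cong-≗ (λ a → sym (*-distribˡ-sum (δ i a + δ i′ a) (g a))))
                           (∑-δ-pair i i′ (λ a → ∑ (g a)))

  ∑∑-δ-cols : ∀ j j′ (g : Fin n → Fin n → ℕ) →
    ∑∑ (λ a b → (δ j b + δ j′ b) * g a b) ≡ ∑[ a < n ] g a j + ∑[ a < n ] g a j′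
  ∑∑-δ-cols j j′ g = trans (sum-cong-≗ (λ a → ∑-δ-pair j j′ (g a))) (∑-distrib-+ (λ a → g a j) (λ a → g a j′))

sum-map-tabulate : ∀ {A : Set} {n} (g : Fin n → A) (h : A → ℕ) →
  sum (map h (tabulate g)) ≡ ∑[ i < n ] h (g i)
sum-map-tabulate {n = zero}  g h = refl
sum-map-tabulate {n = suc n} g h = cong (h (g zero) +_) (sum-map-tabulate (g ∘ suc) h)

sum-map-concatMap : ∀ {A B : Set} (g : A → List B) (h : B → ℕ) xs →
  sum (map h (concatMap g xs)) ≡ sum (map (λ x → sum (map h (g x))) xs)
sum-map-concatMap g h []       = refl
sum-map-concatMap g h (x ∷ xs) = begin
  sum (map h (g x ++ concatMap g xs))             ≡⟨ cong sum (map-++ h (g x) _) ⟩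
  sum (map h (g x) ++ map h (concatMap g xs))     ≡⟨ sum-++ (map h (g x)) _ ⟩
  sum (map h (g x)) + sum (map h (concatMap g xs)) ≡⟨ cong (sum (map h (g x)) +_) (sum-map-concatMap g h xs) ⟩
  sum (map h (g x)) + sum (map (λ x → sum (map h (g x))) xs) ∎
  where open ≡-Reasoning

module _ (n : ℕ) where
  open FinGraph (KnxKn n)

  sum-verts : ∀ (h : Fin n × Fin n → ℕ) → sum (map h verts) ≡ ∑[ i < n ] ∑[ j < n ] h (i , j)
  sum-verts h = begin
    sum (map h verts)
      ≡⟨ sum-map-concatMap (λ i → map (i ,_) (allFin n)) h (allFin n) ⟩
    sum (map (λ i → sum (map h (map (i ,_) (allFin n)))) (allFin n))
      ≡⟨ sum-map-tabulate (λ i → i) (λ i → sum (map h (map (i ,_) (allFin n)))) ⟩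
    ∑[ i < n ] sum (map h (map (i ,_) (allFin n)))
      ≡⟨ sum-cong-≗ (λ i → cong sum (map-∘ {g = h} {f = i ,_} (allFin n))) ⟨
    ∑[ i < n ] sum (map (λ j → h (i , j)) (allFin n))
      ≡⟨ sum-cong-≗ (λ i → sum-map-tabulate (λ j → j) (λ j → h (i , j))) ⟩
    ∑[ i < n ] ∑[ j < n ] h (i , j) ∎
    where open ≡-Reasoning

  card≡∑∑ : ∀ S → card (KnxKn n) S ≡ ∑[ i < n ] ∑[ j < n ] χ (S (i , j))
  card≡∑∑ S = trans (length-filter verts) (sum-verts (χ ∘ S))
    where
    length-filter : ∀ xs → length (filter (λ z → S z Bool.≟ true) xs) ≡ sum (map (χ ∘ S) xs)
    length-filter []       = refl
    length-filter (x ∷ xs) with S x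
    ... | true  = cong suc (length-filter xs)
    ... | false = length-filter xs

-- Distances in K_n × K_n

any-true : ∀ {A : Set} (p : A → Bool) {xs} x → x ∈ xs → p x ≡ true → any p xs ≡ true
any-true p {_ ∷ xs} x (here refl) px = cong (_∨ any p xs) px
any-true p {y ∷ _} x (there x∈xs) px = trans (cong (p y ∨_) (any-true p x x∈xs px)) (∨-zeroʳ (p y))

any-false : ∀ {A : Set} (p : A → Bool) xs → (∀ x → p x ≡ false) → any p xs ≡ false
any-false p []       p≡false = refl
any-false p (x ∷ xs) p≡false = cong₂ _∨_ (p≡false x) (any-false p xs p≡false)

-- arguments: whether the rows agree, whether the columns agree
distance : Bool → Bool → ℕ
distance true  true  = 0
distance true  false = 2
distance false true  = 2
distance false false = 1

distance-comm : ∀ r c → distance r c ≡ distance c r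
distance-comm true  true  = refl
distance-comm true  false = refl
distance-comm false true  = refl
distance-comm false false = refl

⌊≟⌋-refl : ∀ {n} (i : Fin n) → ⌊ i ≟ i ⌋ ≡ true
⌊≟⌋-refl i = trans (isYes≗does (i ≟ i)) (dec-true (i ≟ i) refl)

⌊≟⌋-≢ : ∀ {n} {i a : Fin n} → i ≢ a → ⌊ i ≟ a ⌋ ≡ false
⌊≟⌋-≢ {i = i} {a} i≢a = trans (isYes≗does (i ≟ a)) (dec-false (i ≟ a) i≢a)

⌊≟⌋-disjoint : ∀ {n} {j j′ b : Fin n} → j ≢ j′ → ⌊ j ≟ b ⌋ ∧ ⌊ j′ ≟ b ⌋ ≡ false
⌊≟⌋-disjoint {j = j} {j′} {b} j≢j′ with j ≟ b
... | yes refl = ⌊≟⌋-≢ (j≢j′ ∘ sym)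
... | no _     = refl

∃-≢₂ : ∀ {k} (u v : Fin (3 + k)) → ∃ λ w → w ≢ u × w ≢ v
∃-≢₂ zero          zero          = suc zero , (λ ()) , (λ ())
∃-≢₂ zero          (suc zero)    = suc (suc zero) , (λ ()) , (λ ())
∃-≢₂ zero          (suc (suc _)) = suc zero , (λ ()) , (λ ())
∃-≢₂ (suc zero)    zero          = suc (suc zero) , (λ ()) , (λ ())
∃-≢₂ (suc (suc _)) zero          = suc zero , (λ ()) , (λ ())
∃-≢₂ (suc _)       (suc _)       = zero , (λ ()) , (λ ())

module _ (k : ℕ) where
  private
    n = 3 + k
    G = KnxKn n
  open FinGraph G

  ∈-verts : ∀ x → x ∈ verts
  ∈-verts (i , j) = ∈-concatMap⁺ (λ a → map (a ,_) (allFin n)) (lose (∈-allFin i) (∈-map⁺ (i ,_) (∈-allFin j)))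

  adj-≢ : ∀ {i j a b} → a ≢ i → b ≢ j → adj (i , j) (a , b) ≡ true
  adj-≢ a≢i b≢j = cong₂ (λ r c → not r ∧ not c) (⌊≟⌋-≢ (a≢i ∘ sym)) (⌊≟⌋-≢ (b≢j ∘ sym))

  reach₁≡ : ∀ x y → reach G 1 x y ≡ eqV x y ∨ adj x y
  reach₁≡ x@(i , j) y = cong (eqV x y ∨_) first-step
    where
    first-step : any (λ z → eqV x z ∧ adj z y) verts ≡ adj x y
    first-step with adj x y in adj-xy
    ... | true  = any-true (λ z → eqV x z ∧ adj z y) x (∈-verts x)
                           (cong₂ _∧_ (cong₂ _∧_ (⌊≟⌋-refl i) (⌊≟⌋-refl j)) adj-xy)
    ... | false = any-false _ verts only-x
      where
      only-x : ∀ z → eqV x z ∧ adj z y ≡ false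
      only-x (c , d) with i ≟ c | j ≟ d
      ... | yes refl | yes refl = adj-xy
      ... | yes _    | no _     = refl
      ... | no _     | _        = refl

  reach₂≡true : ∀ x y → reach G 2 x y ≡ true
  reach₂≡true x@(i , j) y@(a , b) with ∃-≢₂ i a | ∃-≢₂ j b
  ... | c , c≢i , c≢a | d , d≢j , d≢b =
    trans (cong (reach G 1 x y ∨_) (any-true (λ z → reach G 1 x z ∧ adj z y) (c , d) (∈-verts (c , d)) z~y))
          (∨-zeroʳ _)
    where
    x~z : reach G 1 x (c , d) ≡ true
    x~z = trans (reach₁≡ x (c , d)) (trans (cong (eqV x (c , d) ∨_) (adj-≢ c≢i d≢j)) (∨-zeroʳ _))
    z~y : reach G 1 x (c , d) ∧ adj (c , d) y ≡ true
    z~y = cong₂ _∧_ x~z (adj-≢ (c≢a ∘ sym) (d≢b ∘ sym))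

  dist≡distance : ∀ i j a b → dist G (i , j) (a , b) ≡ distance ⌊ i ≟ a ⌋ ⌊ j ≟ b ⌋
  dist≡distance i j a b = leastFrom≡distance (length verts) (s≤s (s≤s (s≤s z≤n)))
    where
    x = (i , j)
    y = (a , b)
    by-cases : ∀ r c → (if r ∧ c then 0 else if (r ∧ c) ∨ (not r ∧ not c) then 1 else 2) ≡ distance r c
    by-cases true  true  = refl
    by-cases true  false = refl
    by-cases false true  = refl
    by-cases false false = refl
    leastFrom≡distance : ∀ L → 3 ≤ L → leastFrom G 0 L x y ≡ distance ⌊ i ≟ a ⌋ ⌊ j ≟ b ⌋
    leastFrom≡distance _ (s≤s (s≤s (s≤s {n = L} _))) = begin
      (if eqV x y then 0 else if reach G 1 x y then 1 else if reach G 2 x y then 2 else leastFrom G 3 L x y)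
        ≡⟨ cong₂ (λ r₁ r₂ → if eqV x y then 0 else if r₁ then 1 else if r₂ then 2 else leastFrom G 3 L x y)
                 (reach₁≡ x y) (reach₂≡true x y) ⟩
      (if eqV x y then 0 else if eqV x y ∨ adj x y then 1 else 2)
        ≡⟨ by-cases ⌊ i ≟ a ⌋ ⌊ j ≟ b ⌋ ⟩
      distance ⌊ i ≟ a ⌋ ⌊ j ≟ b ⌋ ∎
      where open ≡-Reasoning

  dist-swap : ∀ i j a b → dist G (i , j) (a , b) ≡ dist G (j , i) (b , a)
  dist-swap i j a b = trans (dist≡distance i j a b) (trans (distance-comm _ _) (sym (dist≡distance j i b a)))

-- Δ_S through row and column counts

module _ (k : ℕ) where
  private
    n = 3 + k
    G = KnxKn n

  gap-aligned : ∀ r c c′ → c ∧ c′ ≡ false → absDiff G (distance r c) (distance r c′) ≡ (χ c + χ c′) * (1 + χ r)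
  gap-aligned true  true  false _ = refl
  gap-aligned true  false true  _ = refl
  gap-aligned true  false false _ = refl
  gap-aligned false true  false _ = refl
  gap-aligned false false true  _ = refl
  gap-aligned false false false _ = refl

  gap-adjacent : ∀ r r′ c c′ → r ∧ r′ ≡ false → c ∧ c′ ≡ false →
    absDiff G (distance r c) (distance r′ c′) + ((χ r + χ r′) * (χ c + χ c′) + (χ r * χ c′ + χ r′ * χ c))
      ≡ χ r + χ r′ + (χ c + χ c′)
  gap-adjacent true  false true  false _ _ = refl
  gap-adjacent true  false false true  _ _ = refl
  gap-adjacent true  false false false _ _ = refl
  gap-adjacent false true  true  false _ _ = refl
  gap-adjacent false true  false true  _ _ = refl
  gap-adjacent false true  false false _ _ = refl
  gap-adjacent false false true  false _ _ = refl
  gap-adjacent false false false true  _ _ = refl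
  gap-adjacent false false false false _ _ = refl

  ΔS≡∑∑ : ∀ S x y → ΔS G S x y ≡ ∑∑ (λ a b → χ (S (a , b)) * Δ G (a , b) x y)
  ΔS≡∑∑ S x y = trans (sum-verts n (λ z → if S z then Δ G z x y else 0))
                      (∑∑-cong (λ a b → if≡χ* (S (a , b)) (Δ G (a , b) x y)))
    where
    if≡χ* : ∀ c v → (if c then v else 0) ≡ χ c * v
    if≡χ* true  v = sym (+-identityʳ v)
    if≡χ* false v = refl

  module _ (S : Fin n × Fin n → Bool) where
    open Counts S

    ΔS-sameRow : ∀ i {j j′} → j ≢ j′ → ΔS G S (i , j) (i , j′) ≡ col j + col j′ + (s i j + s i j′)
    ΔS-sameRow i {j} {j′} j≢j′ = begin
      ΔS G S (i , j) (i , j′)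
        ≡⟨ ΔS≡∑∑ S (i , j) (i , j′) ⟩
      ∑∑ (λ a b → s a b * Δ G (a , b) (i , j) (i , j′))
        ≡⟨ ∑∑-cong (λ a b → trans (cong (s a b *_) (Δ≡ a b)) (expand (s a b) (δ j b + δ j′ b) (δ i a))) ⟩
      ∑∑ (λ a b → (δ j b + δ j′ b) * s a b + δ i a * ((δ j b + δ j′ b) * s a b))
        ≡⟨ ∑∑-+ (λ a b → (δ j b + δ j′ b) * s a b) (λ a b → δ i a * ((δ j b + δ j′ b) * s a b)) ⟩
      ∑∑ (λ a b → (δ j b + δ j′ b) * s a b) + ∑∑ (λ a b → δ i a * ((δ j b + δ j′ b) * s a b))
        ≡⟨ cong₂ _+_ (∑∑-δ-cols j j′ s)
                     (trans (∑∑-δ-row i (λ a b → (δ j b + δ j′ b) * s a b)) (∑-δ-pair j j′ (s i))) ⟩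
      col j + col j′ + (s i j + s i j′) ∎
      where
      open ≡-Reasoning
      Δ≡ : ∀ a b → Δ G (a , b) (i , j) (i , j′) ≡ (δ j b + δ j′ b) * (1 + δ i a)
      Δ≡ a b = trans (cong₂ (absDiff G) (dist≡distance k i j a b) (dist≡distance k i j′ a b))
                     (gap-aligned ⌊ i ≟ a ⌋ ⌊ j ≟ b ⌋ ⌊ j′ ≟ b ⌋ (⌊≟⌋-disjoint j≢j′))
      expand : ∀ x u d → x * (u * (1 + d)) ≡ u * x + d * (u * x)
      expand = solve-∀

    ΔS-adjacent : ∀ {i i′ j j′} → i ≢ i′ → j ≢ j′ →
      ΔS G S (i , j) (i′ , j′) + ((s i j + s i j′) + (s i′ j + s i′ j′) + (s i j′ + s i′ j))
        ≡ row i + row i′ + (col j + col j′)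
    ΔS-adjacent {i} {i′} {j} {j′} i≢i′ j≢j′ = begin
      ΔS G S (i , j) (i′ , j′) + ((s i j + s i j′) + (s i′ j + s i′ j′) + (s i j′ + s i′ j))
        ≡⟨ cong₂ _+_ (ΔS≡∑∑ S (i , j) (i′ , j′)) (sym corner-sum) ⟩
      ∑∑ (λ a b → s a b * Δ G (a , b) (i , j) (i′ , j′)) + ∑∑ corner-terms
        ≡⟨ ∑∑-+ (λ a b → s a b * Δ G (a , b) (i , j) (i′ , j′)) corner-terms ⟨
      ∑∑ (λ a b → s a b * Δ G (a , b) (i , j) (i′ , j′) + corner-terms a b)
        ≡⟨ ∑∑-cong pointwise ⟩
      ∑∑ (λ a b → (δ i a + δ i′ a) * s a b + (δ j b + δ j′ b) * s a b)
        ≡⟨ ∑∑-+ (λ a b → (δ i a + δ i′ a) * s a b) (λ a b → (δ j b + δ j′ b) * s a b) ⟩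
      ∑∑ (λ a b → (δ i a + δ i′ a) * s a b) + ∑∑ (λ a b → (δ j b + δ j′ b) * s a b)
        ≡⟨ cong₂ _+_ (∑∑-δ-rows i i′ s) (∑∑-δ-cols j j′ s) ⟩
      row i + row i′ + (col j + col j′) ∎
      where
      open ≡-Reasoning
      block cross₁ cross₂ corner-terms : Fin n → Fin n → ℕ
      block  a b = (δ i a + δ i′ a) * ((δ j b + δ j′ b) * s a b)
      cross₁ a b = δ i a * (δ j′ b * s a b)
      cross₂ a b = δ i′ a * (δ j b * s a b)
      corner-terms a b = block a b + (cross₁ a b + cross₂ a b)
      corner-sum : ∑∑ corner-terms ≡ (s i j + s i j′) + (s i′ j + s i′ j′) + (s i j′ + s i′ j)
      corner-sum = begin
        ∑∑ corner-terms                                  ≡⟨ ∑∑-+ block (λ a b → cross₁ a b + cross₂ a b) ⟩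
        ∑∑ block + ∑∑ (λ a b → cross₁ a b + cross₂ a b)
                                              ≡⟨ cong (∑∑ block +_) (∑∑-+ cross₁ cross₂) ⟩
        ∑∑ block + (∑∑ cross₁ + ∑∑ cross₂)    ≡⟨ cong₂ _+_ block≡ (cong₂ _+_ cross₁≡ cross₂≡) ⟩
        (s i j + s i j′) + (s i′ j + s i′ j′) + (s i j′ + s i′ j) ∎
        where
        block≡ : ∑∑ block ≡ (s i j + s i j′) + (s i′ j + s i′ j′)
        block≡ = trans (∑∑-δ-rows i i′ (λ a b → (δ j b + δ j′ b) * s a b))
                       (cong₂ _+_ (∑-δ-pair j j′ (s i)) (∑-δ-pair j j′ (s i′)))
        cross₁≡ : ∑∑ cross₁ ≡ s i j′
        cross₁≡ = trans (∑∑-δ-row i (λ a b → δ j′ b * s a b)) (∑-δ j′ (s i))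
        cross₂≡ : ∑∑ cross₂ ≡ s i′ j
        cross₂≡ = trans (∑∑-δ-row i′ (λ a b → δ j b * s a b)) (∑-δ j (s i′))
      pointwise : ∀ a b → s a b * Δ G (a , b) (i , j) (i′ , j′) + corner-terms a b
                            ≡ (δ i a + δ i′ a) * s a b + (δ j b + δ j′ b) * s a b
      pointwise a b = begin
        s a b * Δ G (a , b) (i , j) (i′ , j′) + corner-terms a b
          ≡⟨ factor (s a b) (Δ G (a , b) (i , j) (i′ , j′)) (δ i a) (δ i′ a) (δ j b) (δ j′ b) ⟩
        s a b * (Δ G (a , b) (i , j) (i′ , j′) + cell-weights)
          ≡⟨ cong (s a b *_) Δ+cell-weights ⟩
        s a b * (δ i a + δ i′ a + (δ j b + δ j′ b))
          ≡⟨ distribute (s a b) (δ i a + δ i′ a) (δ j b + δ j′ b) ⟩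
        (δ i a + δ i′ a) * s a b + (δ j b + δ j′ b) * s a b ∎
        where
        cell-weights = (δ i a + δ i′ a) * (δ j b + δ j′ b) + (δ i a * δ j′ b + δ i′ a * δ j b)
        Δ+cell-weights : Δ G (a , b) (i , j) (i′ , j′) + cell-weights ≡ δ i a + δ i′ a + (δ j b + δ j′ b)
        Δ+cell-weights = trans (cong (_+ cell-weights) (cong₂ (absDiff G) (dist≡distance k i j a b) (dist≡distance k i′ j′ a b)))
                               (gap-adjacent ⌊ i ≟ a ⌋ ⌊ i′ ≟ a ⌋ ⌊ j ≟ b ⌋ ⌊ j′ ≟ b ⌋ (⌊≟⌋-disjoint i≢i′) (⌊≟⌋-disjoint j≢j′))
        factor : ∀ x d r r′ c c′ → x * d + ((r + r′) * ((c + c′) * x) + (r * (c′ * x) + r′ * (c * x)))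
                                   ≡ x * (d + ((r + r′) * (c + c′) + (r * c′ + r′ * c)))
        factor = solve-∀
        distribute : ∀ x u v → x * (u + v) ≡ u * x + v * x
        distribute = solve-∀

  ΔS-transpose : ∀ S i j i′ j′ → ΔS G S (i , j) (i′ , j′) ≡ ΔS G (S ∘ swap) (j , i) (j′ , i′)
  ΔS-transpose S i j i′ j′ = begin
    ΔS G S (i , j) (i′ , j′)
      ≡⟨ ΔS≡∑∑ S (i , j) (i′ , j′) ⟩
    ∑∑ (λ a b → χ (S (a , b)) * Δ G (a , b) (i , j) (i′ , j′))
      ≡⟨ ∑-comm (λ a b → χ (S (a , b)) * Δ G (a , b) (i , j) (i′ , j′)) ⟩
    ∑∑ (λ b a → χ (S (a , b)) * Δ G (a , b) (i , j) (i′ , j′))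
      ≡⟨ ∑∑-cong (λ b a → cong (χ (S (a , b)) *_) (cong₂ (absDiff G) (dist-swap k i j a b) (dist-swap k i′ j′ a b))) ⟩
    ∑∑ (λ b a → χ (S (a , b)) * Δ G (b , a) (j , i) (j′ , i′))
      ≡⟨ ΔS≡∑∑ (S ∘ swap) (j , i) (j′ , i′) ⟨
    ΔS G (S ∘ swap) (j , i) (j′ , i′) ∎
    where open ≡-Reasoning

  ΔS-sameCol : ∀ S {i i′} j → i ≢ i′ → let open Counts S in
    ΔS G S (i , j) (i′ , j) ≡ row i + row i′ + (s i j + s i′ j)
  ΔS-sameCol S {i} {i′} j i≢i′ = trans (ΔS-transpose S i j i′ j) (ΔS-sameRow (S ∘ swap) j i≢i′)

-- Lower bound

≤-/ : ∀ x {n} d .{{_ : NonZero d}} → x * d ≤ n → x ≤ n / d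
≤-/ x d xd≤n = subst (_≤ _ / d) (m*n/n≡m x d) (/-monoˡ-≤ d xd≤n)

-- Write p = c j₀ + r + x; every other column then holds at least p + x.
deficient-column-bound : ∀ {n p r} (c : Fin n → ℕ) (j₀ : Fin n) → 2 ≤ n → c j₀ + r ≤ p →
  (∀ j → j ≢ j₀ → p + p ≤ c j₀ + r + c j) → p * n ≤ ∑ c + r
deficient-column-bound {suc (suc n″)} {p} {r} c j₀ (s≤s (s≤s z≤n)) d+r≤p separated = begin
  p * suc n′                     ≡⟨ *-comm p (suc n′) ⟩
  p + n′ * p                     ≡⟨ cong (_+ n′ * p) p≡ ⟩
  d + r + x + n′ * p             ≤⟨ +-monoˡ-≤ (n′ * p) (+-monoʳ-≤ (d + r) (m≤n*m x n′)) ⟩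
  d + r + n′ * x + n′ * p        ≡⟨ rearrange d r (n′ * x) (n′ * p) ⟩
  d + (n′ * x + n′ * p) + r      ≡⟨ cong (λ y → d + y + r) (*-distribˡ-+ n′ x p) ⟨
  d + n′ * (x + p) + r           ≤⟨ +-monoˡ-≤ r (+-monoʳ-≤ d (*-monoʳ-≤ n′ x+p≤b)) ⟩
  d + n′ * b + r                 ≤⟨ +-monoˡ-≤ r (∑-≥-except c j₀ b b≤c) ⟩
  ∑ c + r                        ∎
  where
  open ≤-Reasoning
  n′ = suc n″
  d = c j₀
  x = p ∸ (d + r)
  p≡ : p ≡ d + r + x
  p≡ = sym (m+[n∸m]≡n d+r≤p)
  b = p + p ∸ (d + r)
  x+p≤b : x + p ≤ b
  x+p≤b = ≤-reflexive (sym (+-∸-comm p d+r≤p))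
  b≤c : ∀ j → j ≢ j₀ → b ≤ c j
  b≤c j j≢j₀ = m≤n+o⇒m∸n≤o (p + p) (d + r) (separated j j≢j₀)
  rearrange : ∀ a b c d → a + b + c + d ≡ a + (c + d) + b
  rearrange = solve-∀

module LowerBound {n : ℕ} (S : Fin n × Fin n → Bool) {t p : ℕ} (n≡t+p : n ≡ t + p)
  (separated : Counts.SameRowSeparated S p) where
  open Counts S

  deficient : Fin n → Bool
  deficient j = does (col j <? p)

  one-hole-per-row : ∀ a → ∑[ j < n ] χ (deficient j ∧ not (S (a , j))) ≤ 1
  one-hole-per-row a = ∑-χ-≤1 (λ j → deficient j ∧ not (S (a , j))) unique
    where
    hole : ∀ j → deficient j ∧ not (S (a , j)) ≡ true → suc (col j) ≤ p × s a j ≡ 0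
    hole j = by-cases (col j <? p) (S (a , j)) refl
      where
      by-cases : (d? : Dec (col j < p)) (b : Bool) → S (a , j) ≡ b → does d? ∧ not b ≡ true → suc (col j) ≤ p × s a j ≡ 0
      by-cases (yes col<p) false S≡false _ = col<p , cong χ S≡false
    unique : ∀ j j′ → deficient j ∧ not (S (a , j)) ≡ true → deficient j′ ∧ not (S (a , j′)) ≡ true → j ≡ j′
    unique j j′ hj hj′ with j ≟ j′ | hole j hj | hole j′ hj′
    ... | yes j≡j′ | _ | _ = j≡j′
    ... | no j≢j′ | col<p , s≡0 | col′<p , s′≡0 = ⊥-elim (1+n≰n (≤-trans both-deficient (separated a j≢j′)))
      where
      both-deficient : suc (suc (col j + col j′ + (s a j + s a j′))) ≤ p + p
      both-deficient = begin
        suc (suc (col j + col j′ + (s a j + s a j′))) ≡⟨ cong₂ (λ u v → suc (suc (col j + col j′ + (u + v)))) s≡0 s′≡0 ⟩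
        suc (suc (col j + col j′ + 0))                ≡⟨ cong (λ x → suc (suc x)) (+-identityʳ (col j + col j′)) ⟩
        suc (suc (col j + col j′))                    ≡⟨ cong suc (+-suc (col j) (col j′)) ⟨
        suc (col j) + suc (col j′)                    ≤⟨ +-mono-≤ col<p col′<p ⟩
        p + p                                         ∎
        where open ≤-Reasoning

  module _ (almost-full : ∀ j → p ≤ suc (col j)) where

    p≤col+deficient : ∀ j → p ≤ col j + χ (deficient j)
    p≤col+deficient j = by-cases (col j <? p)
      where
      by-cases : (d? : Dec (col j < p)) → p ≤ col j + χ (does d?)
      by-cases (yes _)    = subst (p ≤_) (+-comm 1 (col j)) (almost-full j)
      by-cases (no col≮p) = ≤-trans (≮⇒≥ col≮p) (m≤m+n (col j) 0)

    holes-in-deficient : ∀ j → χ (deficient j) * suc t ≡ χ (deficient j) * ∑[ a < n ] χ (not (S (a , j)))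
    holes-in-deficient j = by-cases (col j <? p)
      where
      by-cases : (d? : Dec (col j < p)) → χ (does d?) * suc t ≡ χ (does d?) * ∑[ a < n ] χ (not (S (a , j)))
      by-cases (no _)      = refl
      by-cases (yes col<p) = cong (1 *_) (+-cancelʳ-≡ (col j) _ _ (begin
        suc t + col j                                ≡⟨ +-suc t (col j) ⟨
        t + suc (col j)                              ≡⟨ cong (t +_) (≤-antisym col<p (almost-full j)) ⟩
        t + p                                        ≡⟨ n≡t+p ⟨
        n                                            ≡⟨ ∑-χ-not (λ a → S (a , j)) ⟨
        ∑[ a < n ] χ (not (S (a , j))) + col j       ∎))
        where open ≡-Reasoning

    deficient-columns-bound : ∑[ j < n ] χ (deficient j) * suc t ≤ n
    deficient-columns-bound = begin
      ∑[ j < n ] χ (deficient j) * suc t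
        ≡⟨ *-distribʳ-sum (suc t) (χ ∘ deficient) ⟩
      ∑[ j < n ] (χ (deficient j) * suc t)
        ≡⟨ sum-cong-≗ holes-in-deficient ⟩
      ∑[ j < n ] (χ (deficient j) * ∑[ a < n ] χ (not (S (a , j))))
        ≡⟨ sum-cong-≗ (λ j → *-distribˡ-sum (χ (deficient j)) (λ a → χ (not (S (a , j))))) ⟩
      ∑[ j < n ] ∑[ a < n ] (χ (deficient j) * χ (not (S (a , j))))
        ≡⟨ sum-cong-≗ (λ j → sum-cong-≗ (λ a → sym (χ-∧ (deficient j) (not (S (a , j)))))) ⟩
      ∑[ j < n ] ∑[ a < n ] χ (deficient j ∧ not (S (a , j)))
        ≡⟨ ∑-comm (λ j a → χ (deficient j ∧ not (S (a , j)))) ⟩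
      ∑[ a < n ] ∑[ j < n ] χ (deficient j ∧ not (S (a , j)))
        ≤⟨ ∑-mono-≤ one-hole-per-row ⟩
      ∑[ a < n ] 1
        ≡⟨ ∑-one n ⟩
      n ∎
      where open ≤-Reasoning

    few-deficient-columns : p * n ≤ ∑ col + n / suc t
    few-deficient-columns = begin
      p * n                                      ≡⟨ *-comm p n ⟩
      n * p                                      ≡⟨ ∑-const n p ⟨
      ∑[ j < n ] p                               ≤⟨ ∑-mono-≤ p≤col+deficient ⟩
      ∑[ j < n ] (col j + χ (deficient j))       ≡⟨ ∑-distrib-+ col (χ ∘ deficient) ⟩
      ∑ col + ∑[ j < n ] χ (deficient j)         ≤⟨ +-monoʳ-≤ (∑ col) (≤-/ _ (suc t) deficient-columns-bound) ⟩
      ∑ col + n / suc t                          ∎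
      where open ≤-Reasoning

  ∃-hole : ∀ j → col j < n → ∃ λ a → S (a , j) ≡ false
  ∃-hole j col<n with any? (λ a → S (a , j) Bool.≟ false)
  ... | yes hole   = hole
  ... | no no-hole = ⊥-elim (<-irrefl col≡n col<n)
    where
    full : ∀ a → S (a , j) ≡ true
    full a with S (a , j) in S≡
    ... | true  = refl
    ... | false = ⊥-elim (no-hole (a , S≡))
    col≡n : col j ≡ n
    col≡n = trans (sum-cong-≗ (cong χ ∘ full)) (∑-one n)

  beside-hole : ∀ {i₀ j₀} → S (i₀ , j₀) ≡ false → ∀ j → j ≢ j₀ → p + p ≤ col j₀ + 2 + col j
  beside-hole {i₀} {j₀} hole j j≢j₀ = begin
    p + p                                         ≤⟨ separated i₀ (j≢j₀ ∘ sym) ⟩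
    suc (col j₀ + col j + (s i₀ j₀ + s i₀ j))     ≡⟨ cong (λ b → suc (col j₀ + col j + (χ b + s i₀ j))) hole ⟩
    suc (col j₀ + col j + s i₀ j)                 ≤⟨ s≤s (+-monoʳ-≤ (col j₀ + col j) (χ≤1 (S (i₀ , j)))) ⟩
    suc (col j₀ + col j + 1)                      ≡⟨ rearrange (col j₀) (col j) ⟩
    col j₀ + 2 + col j                            ∎
    where
    open ≤-Reasoning
    rearrange : ∀ a b → suc (a + b + 1) ≡ a + 2 + b
    rearrange = solve-∀

  beside-any : p ≤ suc t → ∀ j₀ j → j ≢ j₀ → p + p ≤ col j₀ + 1 + col j
  beside-any p≤1+t j₀ j j≢j₀ with any? (λ a → (S (a , j₀) Bool.≟ false) ×-dec (S (a , j) Bool.≟ false))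
  ... | yes (a , hole₀ , hole) = begin
    p + p                                   ≤⟨ separated a (j≢j₀ ∘ sym) ⟩
    suc (col j₀ + col j + (s a j₀ + s a j)) ≡⟨ cong₂ (λ b b′ → suc (col j₀ + col j + (χ b + χ b′))) hole₀ hole ⟩
    suc (col j₀ + col j + 0)                ≡⟨ rearrange (col j₀) (col j) ⟩
    col j₀ + 1 + col j                      ∎
    where
    open ≤-Reasoning
    rearrange : ∀ a b → suc (a + b + 0) ≡ a + 1 + b
    rearrange = solve-∀
  ... | no no-common-hole = begin
    p + p                                   ≤⟨ +-monoˡ-≤ p p≤1+t ⟩
    suc t + p                               ≡⟨ cong suc n≡t+p ⟨
    suc n                                   ≡⟨ cong suc (∑-one n) ⟨
    suc (∑[ a < n ] 1)                      ≤⟨ s≤s (∑-mono-≤ covered) ⟩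
    suc (∑[ a < n ] (s a j₀ + s a j))       ≡⟨ cong suc (∑-distrib-+ (λ a → s a j₀) (λ a → s a j)) ⟩
    suc (col j₀ + col j)                    ≡⟨ cong (_+ col j) (+-comm (col j₀) 1) ⟨
    col j₀ + 1 + col j                      ∎
    where
    open ≤-Reasoning
    covered : ∀ a → 1 ≤ s a j₀ + s a j
    covered a with S (a , j₀) in S₀ | S (a , j) in S₁
    ... | true  | _     = s≤s z≤n
    ... | false | true  = s≤s z≤n
    ... | false | false = ⊥-elim (no-common-hole (a , S₀ , S₁))

  p≤n : p ≤ n
  p≤n = subst (p ≤_) (sym n≡t+p) (m≤n+m p t)

  deficient-column : ∀ j₀ → col j₀ + 2 ≤ p → p * n ≤ ∑ col + n / suc t
  deficient-column j₀ d+2≤p = by-cases (2 * suc t ≤? n)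
    where
    open ≤-Reasoning
    2≤p : 2 ≤ p
    2≤p = ≤-trans (m≤n+m 2 (col j₀)) d+2≤p
    2≤n : 2 ≤ n
    2≤n = ≤-trans 2≤p p≤n
    by-cases : Dec (2 * suc t ≤ n) → p * n ≤ ∑ col + n / suc t
    by-cases (yes 2[1+t]≤n) = begin
      p * n              ≤⟨ deficient-column-bound col j₀ 2≤n d+2≤p (beside-hole (proj₂ (∃-hole j₀ d<n))) ⟩
      ∑ col + 2          ≤⟨ +-monoʳ-≤ (∑ col) (≤-/ 2 (suc t) 2[1+t]≤n) ⟩
      ∑ col + n / suc t  ∎
      where
      d<n : col j₀ < n
      d<n = <-≤-trans (m<m+n (col j₀) z<s) (≤-trans d+2≤p p≤n)
    by-cases (no 2[1+t]≰n) = begin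
      p * n              ≤⟨ deficient-column-bound col j₀ 2≤n d+1≤p (beside-any p≤1+t j₀) ⟩
      ∑ col + 1          ≤⟨ +-monoʳ-≤ (∑ col) (≤-/ 1 (suc t) 1+t≤n) ⟩
      ∑ col + n / suc t  ∎
      where
      d+1≤p : col j₀ + 1 ≤ p
      d+1≤p = ≤-trans (+-monoʳ-≤ (col j₀) (n≤1+n 1)) d+2≤p
      p≤1+t : p ≤ suc t
      p≤1+t = +-cancelˡ-≤ t p (suc t)
        (subst₂ _≤_ n≡t+p (cong (λ x → t + suc x) (+-identityʳ t)) (≤-pred (≰⇒> 2[1+t]≰n)))
      1+t≤n : 1 * suc t ≤ n
      1+t≤n = subst₂ _≤_ (trans (+-comm t 1) (sym (*-identityˡ (suc t)))) (sym n≡t+p)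
                     (+-monoʳ-≤ t (≤-trans (n≤1+n 1) 2≤p))

  column-bound : p * n ≤ ∑ col + n / suc t
  column-bound with any? (λ j → col j + 2 ≤? p)
  ... | yes (j₀ , d+2≤p)  = deficient-column j₀ d+2≤p
  ... | no none-deficient = few-deficient-columns
    (λ j → ≤-pred (subst (p <_) (+-comm (col j) 2) (≰⇒> (none-deficient ∘ (j ,_)))))

module Arc (n : ℕ) where

  -- x lies in {c, c + 1, …, c + w − 1} taken modulo n
  InArc : ℕ → ℕ → ℕ → Set
  InArc c w x = (c ≤ x × x < c + w) ⊎ (x + n < c + w)

  inArc? : ∀ c w x → Dec (InArc c w x)
  inArc? c w x = ((c ≤? x) ×-dec (x <? c + w)) ⊎-dec (x + n <? c + w)

  private
    χ-arc : ∀ c {w} x → w ≤ n →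
      χ (does (inArc? c w x)) + χ (does (x <? c)) ≡ χ (does (x <? c + w)) + χ (does (x + n <? c + w))
    χ-arc c {w} x w≤n = by-cases (c ≤? x) (x <? c) (x <? c + w) (x + n <? c + w)
      where
      by-cases : (d₁ : Dec (c ≤ x)) (d₂ : Dec (x < c)) (d₃ : Dec (x < c + w)) (d₄ : Dec (x + n < c + w)) →
        χ (does ((d₁ ×-dec d₃) ⊎-dec d₄)) + χ (does d₂) ≡ χ (does d₃) + χ (does d₄)
      by-cases (yes c≤x) (yes x<c) _         _           = ⊥-elim (<⇒≱ x<c c≤x)
      by-cases (no c≰x)  (no x≮c)  _         _           = ⊥-elim (c≰x (≮⇒≥ x≮c))
      by-cases (yes c≤x) (no _)    _         (yes wraps) =
        ⊥-elim (<⇒≱ (+-cancelʳ-< n x c (<-≤-trans wraps (+-monoʳ-≤ c w≤n))) c≤x)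
      by-cases (yes _)   (no _)    (yes _)   (no _)      = refl
      by-cases (yes _)   (no _)    (no _)    (no _)      = refl
      by-cases (no _)    (yes _)   (yes _)   d₄          = +-comm (χ (does d₄)) 1
      by-cases (no _)    (yes x<c) (no x≮c+w) _          = ⊥-elim (x≮c+w (≤-trans x<c (m≤m+n c w)))

  ∑-χ-arc : ∀ c w → c ≤ n → w ≤ n → ∑[ x < n ] χ (does (inArc? c w (toℕ x))) ≡ w
  ∑-χ-arc c w c≤n w≤n = +-cancelʳ-≡ c _ _ (begin
    ∑[ x < n ] arc x + c                                    ≡⟨ cong (∑ arc +_) (m≥n⇒m⊓n≡n c≤n) ⟨
    ∑[ x < n ] arc x + n ⊓ c                                ≡⟨ cong (∑ arc +_) (∑-χ-toℕ< n c) ⟨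
    ∑[ x < n ] arc x + ∑[ x < n ] χ (does (toℕ x <? c))     ≡⟨ ∑-distrib-+ {n} arc (λ x → χ (does (toℕ x <? c))) ⟨
    ∑[ x < n ] (arc x + χ (does (toℕ x <? c)))              ≡⟨ sum-cong-≗ {n} (λ x → χ-arc c (toℕ x) w≤n) ⟩
    ∑[ x < n ] (χ (does (toℕ x <? c + w)) + χ (does (toℕ x + n <? c + w)))
      ≡⟨ ∑-distrib-+ {n} (λ x → χ (does (toℕ x <? c + w))) (λ x → χ (does (toℕ x + n <? c + w))) ⟩
    ∑[ x < n ] χ (does (toℕ x <? c + w)) + ∑[ x < n ] χ (does (toℕ x + n <? c + w))
      ≡⟨ cong₂ _+_ (∑-χ-toℕ< n (c + w)) wrapped ⟩
    n ⊓ (c + w) + (c + w ∸ n)                               ≡⟨ m⊓n+n∸m≡n n (c + w) ⟩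
    c + w                                                   ≡⟨ +-comm c w ⟩
    w + c                                                   ∎)
    where
    open ≡-Reasoning
    arc : Fin n → ℕ
    arc x = χ (does (inArc? c w (toℕ x)))
    wrap⇔ : ∀ x → x + n < c + w ⇔ x < c + w ∸ n
    wrap⇔ x = mk⇔ (m+n≤o⇒m≤o∸n (suc x)) (λ x<c+w∸n → m≤o∸n⇒m+n≤o (suc x) (n≤c+w x<c+w∸n) x<c+w∸n)
      where
      n≤c+w : x < c + w ∸ n → n ≤ c + w
      n≤c+w x<c+w∸n = <⇒≤ (m∸n≢0⇒n<m (λ c+w∸n≡0 → case subst (suc x ≤_) c+w∸n≡0 x<c+w∸n of λ ()))
    wrapped : ∑[ x < n ] χ (does (toℕ x + n <? c + w)) ≡ c + w ∸ n
    wrapped = begin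
      ∑[ x < n ] χ (does (toℕ x + n <? c + w))
        ≡⟨ sum-cong-≗ {n} (λ x → cong χ (does-⇔ (wrap⇔ (toℕ x)) (toℕ x + n <? c + w) (toℕ x <? c + w ∸ n))) ⟩
      ∑[ x < n ] χ (does (toℕ x <? c + w ∸ n))  ≡⟨ ∑-χ-toℕ< n (c + w ∸ n) ⟩
      n ⊓ (c + w ∸ n)                           ≡⟨ m≥n⇒m⊓n≡n (m≤n+o⇒m∸n≤o (c + w) n (+-mono-≤ c≤n w≤n)) ⟩
      c + w ∸ n                                 ∎

module Progression (t : ℕ) where

  Prog : ℕ → ℕ → ℕ → Set
  Prog o zero    x = ⊥
  Prog o (suc k) x = x ≡ o + k * suc t ⊎ Prog o k x

  prog? : ∀ o k x → Dec (Prog o k x)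
  prog? o zero    x = no λ ()
  prog? o (suc k) x = (x ℕ.≟ o + k * suc t) ⊎-dec prog? o k x

  prog⇒ : ∀ {o k x} → Prog o k x → ∃ λ q → q < k × x ≡ o + q * suc t
  prog⇒ {k = suc k} (inj₁ x≡) = k , ≤-refl , x≡
  prog⇒ {k = suc k} (inj₂ px) with prog⇒ px
  ... | q , q<k , x≡ = q , m≤n⇒m≤1+n q<k , x≡

  prog-intro : ∀ {o k q} → q < k → Prog o k (o + q * suc t)
  prog-intro {k = suc k} {q} q<1+k with q ℕ.≟ k
  ... | yes refl = inj₁ refl
  ... | no q≢k   = inj₂ (prog-intro (≤∧≢⇒< (≤-pred q<1+k) q≢k))

  prog-injective : ∀ o {q q′} → o + q * suc t ≡ o + q′ * suc t → q ≡ q′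
  prog-injective o {q} {q′} eq = *-cancelʳ-≡ q q′ (suc t) (+-cancelˡ-≡ o _ _ eq)

  prog-spaced : ∀ o {q q′} → q < q′ → o + q * suc t + t < o + q′ * suc t
  prog-spaced o {q} {q′} q<q′ = begin-strict
    o + q * suc t + t         <⟨ n<1+n _ ⟩
    1 + (o + q * suc t + t)   ≡⟨ rearrange o (q * suc t) t ⟩
    o + suc q * suc t         ≤⟨ +-monoʳ-≤ o (*-monoˡ-≤ (suc t) q<q′) ⟩
    o + q′ * suc t            ∎
    where
    open ≤-Reasoning
    rearrange : ∀ x y z → 1 + (x + y + z) ≡ x + (1 + z + y)
    rearrange = solve-∀

  prog-≥ : ∀ {o k x} → Prog o k x → o ≤ x
  prog-≥ {o} px with prog⇒ px
  ... | q , _ , refl = m≤m+n o (q * suc t)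

  prog-below : ∀ {o k x} → Prog o k x → x + t < o + k * suc t
  prog-below {o} px with prog⇒ px
  ... | q , q<k , refl = prog-spaced o q<k

  prog-apart : ∀ {o k x x′} → Prog o k x → Prog o k x′ → x ≢ x′ → x + t < x′ ⊎ x′ + t < x
  prog-apart {o} px px′ x≢x′ with prog⇒ px | prog⇒ px′
  ... | q , _ , refl | q′ , _ , refl with <-cmp q q′
  ...   | tri< q<q′ _ _ = inj₁ (prog-spaced o q<q′)
  ...   | tri≈ _ refl _ = ⊥-elim (x≢x′ refl)
  ...   | tri> _ _ q′<q = inj₂ (prog-spaced o q′<q)

  prog-count : ∀ {n} o k → o + k * suc t ≤ n → ∑[ x < n ] χ (does (prog? o k (toℕ x))) ≡ k
  prog-count {n} o zero    _    = sum-replicate-zero n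
  prog-count {n} o (suc k) fits = begin
    ∑[ x < n ] χ (does (toℕ x ℕ.≟ o + k * suc t) ∨ does (prog? o k (toℕ x)))
      ≡⟨ sum-cong-≗ {n} (λ x → χ-∨ (does (toℕ x ℕ.≟ o + k * suc t)) (does (prog? o k (toℕ x)))
                                     (dec-false ((toℕ x ℕ.≟ o + k * suc t) ×-dec prog? o k (toℕ x)) newest)) ⟩
    ∑[ x < n ] (χ (does (toℕ x ℕ.≟ o + k * suc t)) + χ (does (prog? o k (toℕ x))))
      ≡⟨ ∑-distrib-+ {n} (λ x → χ (does (toℕ x ℕ.≟ o + k * suc t))) (λ x → χ (does (prog? o k (toℕ x)))) ⟩
    ∑[ x < n ] χ (does (toℕ x ℕ.≟ o + k * suc t)) + ∑[ x < n ] χ (does (prog? o k (toℕ x)))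
      ≡⟨ cong₂ _+_ (∑-χ-toℕ≡ (o + k * suc t) last<n) (prog-count o k (<⇒≤ last<n)) ⟩
    suc k ∎
    where
    open ≡-Reasoning
    newest : ∀ {x} → ¬ (x ≡ o + k * suc t × Prog o k x)
    newest (refl , px) with prog⇒ px
    ... | q , q<k , eq = <-irrefl (sym (prog-injective o eq)) q<k
    last<n : o + k * suc t < n
    last<n = ≤-trans (+-monoʳ-< o (m<n+m (k * suc t) z<s)) fits

  prog-pair : ℕ → ℕ → ℕ → ℕ → ℕ
  prog-pair o k x x′ = χ (does (prog? o k x)) + χ (does (prog? o k x′))

  prog-pair≤ : ∀ o k {x x′} → x ≢ x′ → prog-pair o k x x′ ≤ k
  prog-pair≤ o k {x} {x′} x≢x′ = by-cases (prog? o k x) (prog? o k x′)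
    where
    by-cases : (c? : Dec (Prog o k x)) (c′? : Dec (Prog o k x′)) → χ (does c?) + χ (does c′?) ≤ k
    by-cases (no _)   (no _)    = z≤n
    by-cases (yes px) (no _)    = ≤-trans (s≤s z≤n) (proj₁ (proj₂ (prog⇒ px)))
    by-cases (no _)   (yes px′) = ≤-trans (s≤s z≤n) (proj₁ (proj₂ (prog⇒ px′)))
    by-cases (yes px) (yes px′) with prog⇒ px | prog⇒ px′
    ... | q , q<k , refl | q′ , q′<k , refl with <-cmp q q′
    ...   | tri< q<q′ _ _ = ≤-trans (s≤s (≤-trans (s≤s z≤n) q<q′)) q′<k
    ...   | tri≈ _ refl _ = ⊥-elim (x≢x′ refl)
    ...   | tri> _ _ q′<q = ≤-trans (s≤s (≤-trans (s≤s z≤n) q′<q)) q<k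

  prog-full-pair : ∀ o k {x x′} → 1 ≤ k → k ≤ 2 → x ≢ x′ → k ≤ prog-pair o k x x′ → x ≡ o ⊎ x′ ≡ o
  prog-full-pair o k {x} {x′} 1≤k k≤2 x≢x′ = by-cases (prog? o k x) (prog? o k x′)
    where
    first : ∀ {y} → Prog o k y → k ≤ 1 → y ≡ o
    first py k≤1 with prog⇒ py
    ... | zero , _ , y≡ = trans y≡ (+-identityʳ o)
    ... | suc _ , 2≤k , _ = ⊥-elim (<⇒≱ (≤-trans (s≤s (s≤s z≤n)) 2≤k) k≤1)
    by-cases : (c? : Dec (Prog o k x)) (c′? : Dec (Prog o k x′)) → k ≤ χ (does c?) + χ (does c′?) → x ≡ o ⊎ x′ ≡ o
    by-cases (no _)   (no _)    k≤0 = ⊥-elim (<⇒≱ 1≤k k≤0)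
    by-cases (yes px) (no _)    k≤1 = inj₁ (first px k≤1)
    by-cases (no _)   (yes px′) k≤1 = inj₂ (first px′ k≤1)
    by-cases (yes px) (yes px′) _ with prog⇒ px | prog⇒ px′
    ... | zero , _ , x≡ | _                = inj₁ (trans x≡ (+-identityʳ o))
    ... | _            | zero , _ , x′≡   = inj₂ (trans x′≡ (+-identityʳ o))
    ... | suc (suc _) , 3≤k , _ | _        = ⊥-elim (<⇒≱ (≤-trans (s≤s (s≤s (s≤s z≤n))) 3≤k) k≤2)
    ... | _ | suc (suc _) , 3≤k , _        = ⊥-elim (<⇒≱ (≤-trans (s≤s (s≤s (s≤s z≤n))) 3≤k) k≤2)
    ... | suc zero , _ , refl | suc zero , _ , refl = ⊥-elim (x≢x′ refl)

  prog-near : ∀ {o k x x′} → Prog o k x → Prog o k x′ → x ≤ x′ + t → x′ ≤ x + t → x ≡ x′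
  prog-near {x = x} {x′} px px′ x≤x′+t x′≤x+t with x ℕ.≟ x′
  ... | yes x≡x′ = x≡x′
  ... | no x≢x′ with prog-apart px px′ x≢x′
  ...   | inj₁ x+t<x′ = ⊥-elim (<⇒≱ x+t<x′ x′≤x+t)
  ...   | inj₂ x′+t<x = ⊥-elim (<⇒≱ x′+t<x x≤x′+t)

-- The extremal set

module Construction {n t p : ℕ} (n≡t+p : n ≡ t + p) where
  open Arc n
  open Progression t

  m : ℕ
  m = n / suc t

  -- the rows and columns with t + 1 holes rather than t
  HeavyRow HeavyCol : ℕ → Set
  HeavyRow = Prog 0 m
  HeavyCol = Prog t m

  heavyRow? : ∀ a → Dec (HeavyRow a)
  heavyRow? = prog? 0 m

  heavyCol? : ∀ b → Dec (HeavyCol b)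
  heavyCol? = prog? t m

  Hole : ℕ → ℕ → Set
  Hole a b = InArc a t b ⊎ (HeavyRow a × b ≡ a + t)

  hole? : ∀ a b → Dec (Hole a b)
  hole? a b = inArc? a t b ⊎-dec (heavyRow? a ×-dec (b ℕ.≟ a + t))

  hr hc : ℕ → ℕ
  hr a = χ (does (heavyRow? a))
  hc b = χ (does (heavyCol? b))

  τ : ℕ → ℕ → ℕ
  τ a b = χ (does (hole? a b))

  t≤n : t ≤ n
  t≤n = subst (t ≤_) (sym n≡t+p) (m≤m+n t p)

  heavy-count : ∑[ a < n ] hr (toℕ a) ≡ m
  heavy-count = prog-count 0 m (m/n*n≤m n (suc t))

  heavy-fits : ∀ {a} → HeavyRow a → a + t < n
  heavy-fits ha = <-≤-trans (prog-below ha) (m/n*n≤m n (suc t))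

  private
    extra-off-arc : ∀ {a b} → b ≡ a + t → ¬ InArc a t b
    extra-off-arc refl (inj₁ (_ , a+t<a+t)) = n≮n _ a+t<a+t
    extra-off-arc {a} refl (inj₂ wraps)     = <⇒≱ wraps (m≤m+n (a + t) n)

    χ-hole : ∀ a b → τ a b ≡ χ (does (inArc? a t b)) + χ (does (heavyRow? a) ∧ does (b ℕ.≟ a + t))
    χ-hole a b = χ-∨ (does (inArc? a t b)) (does (heavyRow? a ×-dec (b ℕ.≟ a + t)))
                    (dec-false (inArc? a t b ×-dec (heavyRow? a ×-dec (b ℕ.≟ a + t))) (λ (arc , _ , b≡) → extra-off-arc b≡ arc))

    extra⇔ : ∀ {a b} → (HeavyRow a × b ≡ a + t) ⇔ (HeavyCol b × a ≡ b ∸ t)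
    extra⇔ {a} {b} = mk⇔ to from
      where
      to : HeavyRow a × b ≡ a + t → HeavyCol b × a ≡ b ∸ t
      to (ha , refl) with prog⇒ ha
      ... | q , q<m , refl = subst HeavyCol (+-comm t (q * suc t)) (prog-intro q<m) , sym (m+n∸n≡m _ t)
      from : HeavyCol b × a ≡ b ∸ t → HeavyRow a × b ≡ a + t
      from (hb , refl) with prog⇒ hb
      ... | q , q<m , refl = subst HeavyRow (sym (m+n∸m≡n t _)) (prog-intro q<m) , sym (m∸n+n≡m (m≤m+n t _))

  row-count : ∀ {a} → a < n → ∑[ b < n ] τ a (toℕ b) ≡ t + hr a
  row-count {a} a<n = begin
    ∑[ b < n ] τ a (toℕ b)
      ≡⟨ sum-cong-≗ {n} (χ-hole a ∘ toℕ) ⟩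
    ∑[ b < n ] (χ (does (inArc? a t (toℕ b))) + χ (does (heavyRow? a) ∧ does (toℕ b ℕ.≟ a + t)))
      ≡⟨ ∑-distrib-+ {n} (λ b → χ (does (inArc? a t (toℕ b)))) (λ b → χ (does (heavyRow? a) ∧ does (toℕ b ℕ.≟ a + t))) ⟩
    ∑[ b < n ] χ (does (inArc? a t (toℕ b))) + ∑[ b < n ] χ (does (heavyRow? a) ∧ does (toℕ b ℕ.≟ a + t))
      ≡⟨ cong₂ _+_ (∑-χ-arc a t (<⇒≤ a<n) t≤n) (∑-χ-guarded≡ (heavyRow? a) (a + t) heavy-fits) ⟩
    t + hr a ∎
    where open ≡-Reasoning

  arc-column : ∀ {b} → b < n → ∃ λ c → c ≤ n × (∀ {a} → a < n → InArc a t b ⇔ InArc c t a)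
  arc-column {b} b<n with t ≤? b
  ... | yes t≤b = suc b ∸ t , ≤-trans (m∸n≤m (suc b) t) b<n , λ a<n → mk⇔ (to a<n) from
    where
    c+t≡ : suc b ∸ t + t ≡ suc b
    c+t≡ = m∸n+n≡m (m≤n⇒m≤1+n t≤b)
    to : ∀ {a} → a < n → InArc a t b → InArc (suc b ∸ t) t a
    to {a} _ (inj₁ (a≤b , b<a+t)) =
      inj₁ (+-cancelʳ-≤ t _ a (subst (_≤ a + t) (sym c+t≡) b<a+t) , subst (a <_) (sym c+t≡) (s≤s a≤b))
    to {a} a<n (inj₂ wraps) = ⊥-elim (<⇒≱ wraps (≤-trans (+-mono-≤ (<⇒≤ a<n) t≤b) (≤-reflexive (+-comm n b))))
    from : ∀ {a} → InArc (suc b ∸ t) t a → InArc a t b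
    from {a} (inj₁ (c≤a , a<c+t)) = inj₁ (≤-pred (subst (a <_) c+t≡ a<c+t) , subst (_≤ a + t) c+t≡ (+-monoˡ-≤ t c≤a))
    from {a} (inj₂ wraps) = ⊥-elim (<⇒≱ (subst (a + n <_) c+t≡ wraps) (≤-trans b<n (m≤n+m n a)))
  ... | no t≰b = suc b + n ∸ t , c≤n , λ a<n → mk⇔ (to a<n) from
    where
    b<t : b < t
    b<t = ≰⇒> t≰b
    c+t≡ : suc b + n ∸ t + t ≡ suc b + n
    c+t≡ = m∸n+n≡m (≤-trans t≤n (m≤n+m n (suc b)))
    c≤n : suc b + n ∸ t ≤ n
    c≤n = m≤n+o⇒m∸n≤o (suc b + n) t (+-monoˡ-≤ n b<t)
    to : ∀ {a} → a < n → InArc a t b → InArc (suc b + n ∸ t) t a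
    to {a} _   (inj₁ (a≤b , _)) = inj₂ (subst (a + n <_) (sym c+t≡) (s≤s (+-monoˡ-≤ n a≤b)))
    to {a} a<n (inj₂ wraps)     =
      inj₁ (+-cancelʳ-≤ t _ a (subst (_≤ a + t) (sym c+t≡) wraps) , subst (a <_) (sym c+t≡) (≤-trans a<n (m≤n+m n (suc b))))
    from : ∀ {a} → InArc (suc b + n ∸ t) t a → InArc a t b
    from {a} (inj₁ (c≤a , _)) = inj₂ (subst (_≤ a + t) c+t≡ (+-monoˡ-≤ t c≤a))
    from {a} (inj₂ wraps)     = inj₁ (≤-pred (+-cancelʳ-< n a (suc b) (subst (a + n <_) c+t≡ wraps)) , ≤-trans b<t (m≤n+m t a))

  col-count : ∀ {b} → b < n → ∑[ a < n ] τ (toℕ a) b ≡ t + hc b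
  col-count {b} b<n with arc-column b<n
  ... | c , c≤n , arc⇔ = begin
    ∑[ a < n ] τ (toℕ a) b
      ≡⟨ sum-cong-≗ {n} (λ a → χ-hole (toℕ a) b) ⟩
    ∑[ a < n ] (χ (does (inArc? (toℕ a) t b)) + χ (does (heavyRow? (toℕ a)) ∧ does (b ℕ.≟ toℕ a + t)))
      ≡⟨ ∑-distrib-+ {n} (λ a → χ (does (inArc? (toℕ a) t b))) (λ a → χ (does (heavyRow? (toℕ a)) ∧ does (b ℕ.≟ toℕ a + t))) ⟩
    ∑[ a < n ] χ (does (inArc? (toℕ a) t b)) + ∑[ a < n ] χ (does (heavyRow? (toℕ a)) ∧ does (b ℕ.≟ toℕ a + t))
      ≡⟨ cong₂ _+_ arc-part extra-part ⟩
    t + hc b ∎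
    where
    open ≡-Reasoning
    arc-part : ∑[ a < n ] χ (does (inArc? (toℕ a) t b)) ≡ t
    arc-part = trans (sum-cong-≗ {n} (λ a → cong χ (does-⇔ (arc⇔ (toℕ<n a)) (inArc? (toℕ a) t b) (inArc? c t (toℕ a)))))
                     (∑-χ-arc c t c≤n t≤n)
    extra-part : ∑[ a < n ] χ (does (heavyRow? (toℕ a)) ∧ does (b ℕ.≟ toℕ a + t)) ≡ hc b
    extra-part = trans (sum-cong-≗ {n} (λ a → cong χ (does-⇔ extra⇔ (heavyRow? (toℕ a) ×-dec (b ℕ.≟ toℕ a + t))
                                                                   (heavyCol? b ×-dec (toℕ a ℕ.≟ b ∸ t)))))
                       (∑-χ-guarded≡ (heavyCol? b) (b ∸ t) (λ _ → ≤-<-trans (m∸n≤m b t) b<n))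

  hole-near : ∀ {a b} → a + t < b + n → Hole a b → a ≤ b × b ≤ a + t
  hole-near _       (inj₁ (inj₁ (a≤b , b<a+t))) = a≤b , <⇒≤ b<a+t
  hole-near a+t<b+n (inj₁ (inj₂ wraps))         = ⊥-elim (<-asym a+t<b+n wraps)
  hole-near {a}     _ (inj₂ (_ , refl))         = m≤m+n a t , ≤-refl

  row-conflict : ∀ {a b b′} → a < n → HeavyCol b → HeavyCol b′ → Hole a b → Hole a b′ → b ≡ b′
  row-conflict {a} {b} {b′} a<n hb hb′ ab ab′ =
    prog-near hb hb′ (≤-trans b≤a+t (+-monoˡ-≤ t a≤b′)) (≤-trans b′≤a+t (+-monoˡ-≤ t a≤b))
    where
    fits : ∀ {c} → HeavyCol c → a + t < c + n
    fits {c} hc = subst (a + t <_) (+-comm n c) (+-mono-<-≤ a<n (prog-≥ hc))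
    a≤b = proj₁ (hole-near (fits hb) ab)
    b≤a+t = proj₂ (hole-near (fits hb) ab)
    a≤b′ = proj₁ (hole-near (fits hb′) ab′)
    b′≤a+t = proj₂ (hole-near (fits hb′) ab′)

  col-conflict : ∀ {a a′ b} → HeavyRow a → HeavyRow a′ → Hole a b → Hole a′ b → a ≡ a′
  col-conflict {a} {a′} {b} ha ha′ ab a′b =
    prog-near ha ha′ (≤-trans a≤b (proj₂ (near ha′ a′b))) (≤-trans (proj₁ (near ha′ a′b)) b≤a+t)
    where
    near : ∀ {c} → HeavyRow c → Hole c b → c ≤ b × b ≤ c + t
    near hc = hole-near (<-≤-trans (heavy-fits hc) (m≤n+m n b))
    a≤b = proj₁ (near ha ab)
    b≤a+t = proj₂ (near ha ab)

  row-pair-bound : ∀ {a b b′} → a < n → b ≢ b′ → hc b + hc b′ + τ a b + τ a b′ ≤ 3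
  row-pair-bound {a} {b} {b′} a<n b≢b′ =
    χ-not-all (does (heavyCol? b)) (does (heavyCol? b′)) (does (hole? a b)) (does (hole? a b′))
      (dec-false (heavyCol? b ×-dec (heavyCol? b′ ×-dec (hole? a b ×-dec hole? a b′)))
                 λ (hb , hb′ , ab , ab′) → b≢b′ (row-conflict a<n hb hb′ ab ab′))

  col-pair-bound : ∀ {a a′ b} → a ≢ a′ → hr a + hr a′ + τ a b + τ a′ b ≤ 3
  col-pair-bound {a} {a′} {b} a≢a′ =
    χ-not-all (does (heavyRow? a)) (does (heavyRow? a′)) (does (hole? a b)) (does (hole? a′ b))
      (dec-false (heavyRow? a ×-dec (heavyRow? a′ ×-dec (hole? a b ×-dec hole? a′ b)))
                 λ (ha , ha′ , ab , a′b) → a≢a′ (col-conflict ha ha′ ab a′b))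

  -- the four cells spanned by rows a, a′ and columns b, b′, weighted as in ΔS-adjacent
  cells : ℕ → ℕ → ℕ → ℕ → ℕ
  cells a a′ b b′ = (τ a b + τ a b′) + (τ a′ b + τ a′ b′) + (τ a b′ + τ a′ b)

  corner-in-cells : 1 ≤ m → ∀ {a a′ b b′} → a ≡ 0 ⊎ a′ ≡ 0 → b ≡ t ⊎ b′ ≡ t → 1 ≤ cells a a′ b b′
  corner-in-cells 1≤m {a} {a′} {b} {b′} a₀ b₀ = ≤-trans corner (cases a₀ b₀)
    where
    corner : 1 ≤ τ 0 t
    corner = ≤-reflexive (sym (cong χ (dec-true (hole? 0 t) (inj₂ (prog-intro 1≤m , refl)))))
    row≤ : τ a b + τ a b′ ≤ cells a a′ b b′
    row≤ = ≤-trans (m≤m+n _ _) (m≤m+n _ _)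
    row′≤ : τ a′ b + τ a′ b′ ≤ cells a a′ b b′
    row′≤ = ≤-trans (m≤n+m _ (τ a b + τ a b′)) (m≤m+n _ _)
    cases : a ≡ 0 ⊎ a′ ≡ 0 → b ≡ t ⊎ b′ ≡ t → τ 0 t ≤ cells a a′ b b′
    cases (inj₁ refl) (inj₁ refl) = ≤-trans (m≤m+n _ _) row≤
    cases (inj₁ refl) (inj₂ refl) = ≤-trans (m≤n+m _ _) row≤
    cases (inj₂ refl) (inj₁ refl) = ≤-trans (m≤m+n _ _) row′≤
    cases (inj₂ refl) (inj₂ refl) = ≤-trans (m≤n+m _ _) row′≤

  1≤p⇒1≤m : 1 ≤ p → 1 ≤ m
  1≤p⇒1≤m 1≤p = ≤-/ 1 (suc t)
    (subst₂ _≤_ (trans (+-comm t 1) (sym (*-identityˡ (suc t)))) (sym n≡t+p) (+-monoʳ-≤ t 1≤p))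

  p≤4⇒m≤2 : 1 ≤ t → p ≤ 4 → m ≤ 2
  p≤4⇒m≤2 1≤t p≤4 = ≮⇒≥ λ 3≤m → <⇒≱ (≤-trans (s≤s (s≤s (s≤s (s≤s (s≤s z≤n))))) (5≤p 3≤m)) p≤4
    where
    5≤p : 3 ≤ m → 5 ≤ p
    5≤p 3≤m = ≤-trans (+-monoˡ-≤ 3 (+-mono-≤ 1≤t 1≤t)) (+-cancelˡ-≤ t _ _ (begin
      t + (t + t + 3)   ≡⟨ three-blocks t ⟩
      3 * suc t         ≤⟨ *-monoˡ-≤ (suc t) 3≤m ⟩
      m * suc t         ≤⟨ m/n*n≤m n (suc t) ⟩
      n                 ≡⟨ n≡t+p ⟩
      t + p             ∎))
      where
      open ≤-Reasoning
      three-blocks : ∀ t → t + (t + t + 3) ≡ 3 * (1 + t)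
      three-blocks = solve-∀

  m≤2⇒m+2≤p : 3 ≤ p → 6 ≤ n → m ≤ 2 → m + 2 ≤ p
  m≤2⇒m+2≤p 3≤p 6≤n m≤2 with m ≤? 1
  ... | yes m≤1 = ≤-trans (+-monoˡ-≤ 2 m≤1) 3≤p
  ... | no m≰1 = ≤-trans (+-monoˡ-≤ 2 m≤2) 4≤p
    where
    open ≤-Reasoning
    t+2≤p : t + 2 ≤ p
    t+2≤p = +-cancelˡ-≤ t _ _ (begin
      t + (t + 2)  ≡⟨ two-blocks t ⟩
      2 * suc t    ≤⟨ *-monoˡ-≤ (suc t) (≰⇒> m≰1) ⟩
      m * suc t    ≤⟨ m/n*n≤m n (suc t) ⟩
      n            ≡⟨ n≡t+p ⟩
      t + p        ∎)
      where
      two-blocks : ∀ t → t + (t + 2) ≡ 2 * (1 + t)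
      two-blocks = solve-∀
    8≤p+p : 8 ≤ p + p
    8≤p+p = begin
      8            ≤⟨ +-monoˡ-≤ 2 6≤n ⟩
      n + 2        ≡⟨ cong (_+ 2) n≡t+p ⟩
      t + p + 2    ≡⟨ swap-last t p 2 ⟩
      t + 2 + p    ≤⟨ +-monoˡ-≤ p t+2≤p ⟩
      p + p        ∎
      where
      swap-last : ∀ x y z → x + y + z ≡ x + z + y
      swap-last = solve-∀
    4≤p : 4 ≤ p
    4≤p = ≮⇒≥ λ p<4 → <⇒≱ (≤-trans (s≤s (+-mono-≤ (≤-pred p<4) (≤-pred p<4))) (n≤1+n 7)) 8≤p+p

  saturated-pair : 1 ≤ m → m ≤ 2 → ∀ {a a′ b b′} → a ≢ a′ → b ≢ b′ →
    m + m ≤ hr a + hr a′ + (hc b + hc b′) → 1 ≤ cells a a′ b b′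
  saturated-pair 1≤m m≤2 {a} {a′} {b} {b′} a≢a′ b≢b′ m+m≤ = corner-in-cells 1≤m a₀ b₀
    where
    hR≤m : hr a + hr a′ ≤ m
    hR≤m = prog-pair≤ 0 m a≢a′
    hC≤m : hc b + hc b′ ≤ m
    hC≤m = prog-pair≤ t m b≢b′
    a₀ : a ≡ 0 ⊎ a′ ≡ 0
    a₀ = prog-full-pair 0 m 1≤m m≤2 a≢a′ (≮⇒≥ λ hR<m → <⇒≱ (+-mono-<-≤ hR<m hC≤m) m+m≤)
    b₀ : b ≡ t ⊎ b′ ≡ t
    b₀ = prog-full-pair t m 1≤m m≤2 b≢b′ (≮⇒≥ λ hC<m → <⇒≱ (+-mono-≤-< hR≤m hC<m) m+m≤)

  -- For p ≥ 5 there is room to spare. Otherwise m ≤ 2, and a pair using up all the slack must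
  -- contain every heavy row and every heavy column, in particular row 0 and column t, whose
  -- common cell is a hole.
  adjacent-bound : 1 ≤ t → 3 ≤ p → 6 ≤ n → ∀ {a a′ b b′} → a ≢ a′ → b ≢ b′ →
    hr a + hr a′ + (hc b + hc b′) + 5 ≤ p + p + cells a a′ b b′
  adjacent-bound 1≤t 3≤p 6≤n {a} {a′} {b} {b′} a≢a′ b≢b′ with 5 ≤? p
  ... | yes 5≤p = ≤-trans (+-monoˡ-≤ 5 (+-mono-≤ (pair≤2 0 a a′) (pair≤2 t b b′)))
                          (≤-trans (≤-trans (n≤1+n 9) (+-mono-≤ 5≤p 5≤p)) (m≤m+n (p + p) _))
    where
    pair≤2 : ∀ o x x′ → prog-pair o m x x′ ≤ 2
    pair≤2 o x x′ = +-mono-≤ (χ≤1 (does (prog? o m x))) (χ≤1 (does (prog? o m x′)))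
  ... | no 5≰p with hr a + hr a′ + (hc b + hc b′) + 5 ≤? p + p
  ...   | yes loose = ≤-trans loose (m≤m+n (p + p) _)
  ...   | no tight = begin
    hr a + hr a′ + (hc b + hc b′) + 5  ≤⟨ +-monoˡ-≤ 5 (+-mono-≤ (prog-pair≤ 0 m a≢a′) (prog-pair≤ t m b≢b′)) ⟩
    m + m + 5                          ≡⟨ regroup m ⟩
    (m + 2) + (m + 2) + 1              ≤⟨ +-mono-≤ (+-mono-≤ m+2≤p m+2≤p) (saturated-pair 1≤m m≤2 a≢a′ b≢b′ m+m≤) ⟩
    p + p + cells a a′ b b′            ∎
    where
    open ≤-Reasoning
    regroup : ∀ m → m + m + 5 ≡ (m + 2) + (m + 2) + 1
    regroup = solve-∀
    1≤m : 1 ≤ m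
    1≤m = 1≤p⇒1≤m (≤-trans (s≤s z≤n) 3≤p)
    m≤2 : m ≤ 2
    m≤2 = p≤4⇒m≤2 1≤t (≤-pred (≰⇒> 5≰p))
    m+2≤p : m + 2 ≤ p
    m+2≤p = m≤2⇒m+2≤p 3≤p 6≤n m≤2
    m+m≤ : m + m ≤ hr a + hr a′ + (hc b + hc b′)
    m+m≤ = +-cancelʳ-≤ 5 _ _ (begin
      m + m + 5                          ≡⟨ regroup′ m ⟩
      1 + ((m + 2) + (m + 2))            ≤⟨ s≤s (+-mono-≤ m+2≤p m+2≤p) ⟩
      1 + (p + p)                        ≤⟨ ≰⇒> tight ⟩
      hr a + hr a′ + (hc b + hc b′) + 5  ∎)
      where
      regroup′ : ∀ m → m + m + 5 ≡ 1 + ((m + 2) + (m + 2))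
      regroup′ = solve-∀

aligned-bound : ∀ {p c c′ x x′ h h′ y y′} → c + h ≡ p → c′ + h′ ≡ p → x + y ≡ 1 → x′ + y′ ≡ 1 →
  h + h′ + y + y′ ≤ 3 → p + p ≤ suc (c + c′ + (x + x′))
aligned-bound {p} {c} {c′} {x} {x′} {h} {h′} {y} {y′} c+h≡p c′+h′≡p x+y≡1 x′+y′≡1 few = +-cancelʳ-≤ 2 _ _ (begin
  p + p + 2                                      ≡⟨ cong₂ _+_ (cong₂ _+_ c+h≡p c′+h′≡p) (cong₂ _+_ x+y≡1 x′+y′≡1) ⟨
  (c + h) + (c′ + h′) + ((x + y) + (x′ + y′))    ≡⟨ regroup c c′ x x′ h h′ y y′ ⟨
  c + c′ + (x + x′) + (h + h′ + y + y′)          ≤⟨ +-monoʳ-≤ (c + c′ + (x + x′)) few ⟩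
  c + c′ + (x + x′) + 3                          ≡⟨ +-suc _ 2 ⟩
  suc (c + c′ + (x + x′)) + 2                    ∎)
  where
  open ≤-Reasoning
  regroup : ∀ c c′ x x′ h h′ y y′ →
    c + c′ + (x + x′) + (h + h′ + y + y′) ≡ (c + h) + (c′ + h′) + ((x + y) + (x′ + y′))
  regroup = solve-∀

balance-bound : ∀ {D Y B W Q} → D + Y + B ≡ Q + Q → Y + W ≡ 6 → B + 5 ≤ Q + W → Q ≤ suc D
balance-bound {D} {Y} {B} {W} {Q} balance Y+W≡6 B+5≤ = +-cancelʳ-≤ 5 Q (suc D) (+-cancelʳ-≤ Q _ _ (begin
  Q + 5 + Q           ≡⟨ +-comm (Q + 5) Q ⟩
  Q + (Q + 5)         ≡⟨ +-assoc Q Q 5 ⟨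
  Q + Q + 5           ≡⟨ cong (_+ 5) balance ⟨
  D + Y + B + 5       ≡⟨ +-assoc (D + Y) B 5 ⟩
  D + Y + (B + 5)     ≤⟨ +-monoʳ-≤ (D + Y) B+5≤ ⟩
  D + Y + (Q + W)     ≡⟨ regroup D Y Q W ⟩
  D + (Y + W) + Q     ≡⟨ cong (λ x → D + x + Q) Y+W≡6 ⟩
  D + 6 + Q           ≡⟨ cong (_+ Q) (+-suc D 5) ⟩
  suc D + 5 + Q       ∎))
  where
  open ≤-Reasoning
  regroup : ∀ d y q w → d + y + (q + w) ≡ d + (y + w) + q
  regroup = solve-∀

module _ (k : ℕ) {t p : ℕ} (n≡t+p : 3 + k ≡ t + p) where
  private
    n = 3 + k
    G = KnxKn n

  2n∸2t≡p+p : 2 * n ∸ 2 * t ≡ p + p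
  2n∸2t≡p+p = begin
    2 * n ∸ 2 * t          ≡⟨ cong (λ x → 2 * x ∸ 2 * t) n≡t+p ⟩
    2 * (t + p) ∸ 2 * t    ≡⟨ cong (_∸ 2 * t) (*-distribˡ-+ 2 t p) ⟩
    2 * t + 2 * p ∸ 2 * t  ≡⟨ m+n∸m≡n (2 * t) (2 * p) ⟩
    2 * p                  ≡⟨ cong (p +_) (+-identityʳ p) ⟩
    p + p                  ∎
    where open ≡-Reasoning

  bound⇔ : ∀ D → 2 * n ∸ 2 * t ∸ 1 ≤ D ⇔ p + p ≤ suc D
  bound⇔ D rewrite 2n∸2t≡p+p = mk⇔ (λ le → ≤-trans (m≤n+m∸n (p + p) 1) (s≤s le)) (m≤n+o⇒m∸n≤o (p + p) 1)

  n*n∸t*n≡ : n * n ∸ t * n ≡ p * n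
  n*n∸t*n≡ = begin
    n * n ∸ t * n          ≡⟨ cong (λ x → x * n ∸ t * n) n≡t+p ⟩
    (t + p) * n ∸ t * n    ≡⟨ cong (_∸ t * n) (*-distribʳ-+ n t p) ⟩
    t * n + p * n ∸ t * n  ≡⟨ m+n∸m≡n (t * n) (p * n) ⟩
    p * n                  ∎
    where open ≡-Reasoning

  eqV-sameRow : ∀ i {j j′} → j ≢ j′ → FinGraph.eqV G (i , j) (i , j′) ≡ false
  eqV-sameRow i {j} {j′} j≢j′ = trans (cong (_∧ ⌊ j ≟ j′ ⌋) (⌊≟⌋-refl i)) (⌊≟⌋-≢ j≢j′)

  card-lower-bound : ∀ S → IsWeakResolving G (2 * n ∸ 2 * t ∸ 1) S → n * n ∸ t * n ∸ n / suc t ≤ card G S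
  card-lower-bound S resolving = begin
    n * n ∸ t * n ∸ n / suc t  ≡⟨ cong (_∸ n / suc t) n*n∸t*n≡ ⟩
    p * n ∸ n / suc t          ≤⟨ m≤n+o⇒m∸n≤o (p * n) (n / suc t) (subst (p * n ≤_) (+-comm (∑ col) _) column-bound) ⟩
    ∑ col                      ≡⟨ trans (card≡∑∑ n S) (∑-comm (λ a b → s a b)) ⟨
    card G S                   ∎
    where
    open ≤-Reasoning
    open Counts S
    separated : SameRowSeparated p
    separated i {j} {j′} j≢j′ = Equivalence.to (bound⇔ _)
      (subst (2 * n ∸ 2 * t ∸ 1 ≤_) (ΔS-sameRow k S i j≢j′) (resolving (i , j) (i , j′) (eqV-sameRow i j≢j′)))
    open LowerBound S {t} {p} n≡t+p separated

  module _ (1≤t : 1 ≤ t) (3≤p : 3 ≤ p) (6≤n : 6 ≤ n) where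
    open Construction {n} {t} {p} n≡t+p

    S⋆ : Fin n × Fin n → Bool
    S⋆ (i , j) = not (does (hole? (toℕ i) (toℕ j)))

    open Counts S⋆

    s+τ : ∀ i j → s i j + τ (toℕ i) (toℕ j) ≡ 1
    s+τ i j = χ-not (does (hole? (toℕ i) (toℕ j)))

    row+heavy : ∀ i → row i + hr (toℕ i) ≡ p
    row+heavy i = +-cancelˡ-≡ t _ _ (begin
      t + (row i + hr (toℕ i))                   ≡⟨ x∙yz≈y∙xz t (row i) _ ⟩
      row i + (t + hr (toℕ i))                   ≡⟨ cong (row i +_) (row-count (toℕ<n i)) ⟨
      row i + ∑[ b < n ] τ (toℕ i) (toℕ b)       ≡⟨ ∑-χ-not (λ b → does (hole? (toℕ i) (toℕ b))) ⟩
      n                                          ≡⟨ n≡t+p ⟩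
      t + p                                      ∎)
      where open ≡-Reasoning

    col+heavy : ∀ j → col j + hc (toℕ j) ≡ p
    col+heavy j = +-cancelˡ-≡ t _ _ (begin
      t + (col j + hc (toℕ j))                    ≡⟨ x∙yz≈y∙xz t (col j) _ ⟩
      col j + (t + hc (toℕ j))                    ≡⟨ cong (col j +_) (col-count (toℕ<n j)) ⟨
      col j + ∑[ a < n ] τ (toℕ a) (toℕ j)        ≡⟨ ∑-χ-not (λ a → does (hole? (toℕ a) (toℕ j))) ⟩
      n                                           ≡⟨ n≡t+p ⟩
      t + p                                       ∎)
      where open ≡-Reasoning

    card⋆ : card G S⋆ ≡ n * n ∸ t * n ∸ n / suc t
    card⋆ = begin
      card G S⋆                                 ≡⟨ card≡∑∑ n S⋆ ⟩
      ∑ row                                     ≡⟨ m+n∸n≡m (∑ row) m ⟨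
      ∑ row + m ∸ m                             ≡⟨ cong (λ x → ∑ row + x ∸ m) heavy-count ⟨
      ∑ row + ∑[ i < n ] hr (toℕ i) ∸ m         ≡⟨ cong (_∸ m) (∑-distrib-+ row (hr ∘ toℕ)) ⟨
      ∑[ i < n ] (row i + hr (toℕ i)) ∸ m       ≡⟨ cong (_∸ m) (sum-cong-≗ row+heavy) ⟩
      ∑[ i < n ] p ∸ m                          ≡⟨ cong (_∸ m) (trans (∑-const n p) (*-comm n p)) ⟩
      p * n ∸ m                                 ≡⟨ cong (_∸ m) n*n∸t*n≡ ⟨
      n * n ∸ t * n ∸ m                         ∎
      where open ≡-Reasoning

    sameRow-separated : ∀ i {j j′} → j ≢ j′ → p + p ≤ suc (ΔS G S⋆ (i , j) (i , j′))
    sameRow-separated i {j} {j′} j≢j′ = subst (λ D → p + p ≤ suc D) (sym (ΔS-sameRow k S⋆ i j≢j′))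
      (aligned-bound {c = col j} {col j′} {s i j} {s i j′} {hc b} {hc b′} {τ a b} {τ a b′}
                     (col+heavy j) (col+heavy j′) (s+τ i j) (s+τ i j′) (row-pair-bound a<n (j≢j′ ∘ toℕ-injective)))
      where
      a = toℕ i
      b = toℕ j
      b′ = toℕ j′
      a<n = toℕ<n i

    sameCol-separated : ∀ j {i i′} → i ≢ i′ → p + p ≤ suc (ΔS G S⋆ (i , j) (i′ , j))
    sameCol-separated j {i} {i′} i≢i′ = subst (λ D → p + p ≤ suc D) (sym (ΔS-sameCol k S⋆ j i≢i′))
      (aligned-bound {c = row i} {row i′} {s i j} {s i′ j} {hr a} {hr a′} {τ a b} {τ a′ b}
                     (row+heavy i) (row+heavy i′) (s+τ i j) (s+τ i′ j) (col-pair-bound (i≢i′ ∘ toℕ-injective)))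
      where
      a = toℕ i
      a′ = toℕ i′
      b = toℕ j

    adjacent-separated : ∀ {i i′ j j′} → i ≢ i′ → j ≢ j′ → p + p ≤ suc (ΔS G S⋆ (i , j) (i′ , j′))
    adjacent-separated {i} {i′} {j} {j′} i≢i′ j≢j′ =
      balance-bound (trans (cong (_+ heavy-pairs) (ΔS-adjacent k S⋆ i≢i′ j≢j′)) balance) complement
                    (adjacent-bound 1≤t 3≤p 6≤n (i≢i′ ∘ toℕ-injective) (j≢j′ ∘ toℕ-injective))
      where
      a = toℕ i
      a′ = toℕ i′
      b = toℕ j
      b′ = toℕ j′
      heavy-pairs = hr a + hr a′ + (hc b + hc b′)
      regroup : ∀ r r′ c c′ h h′ g g′ →
        r + r′ + (c + c′) + (h + h′ + (g + g′)) ≡ (r + h) + (r′ + h′) + ((c + g) + (c′ + g′))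
      regroup = solve-∀
      balance : row i + row i′ + (col j + col j′) + heavy-pairs ≡ (p + p) + (p + p)
      balance = trans (regroup (row i) (row i′) (col j) (col j′) _ _ _ _)
                      (cong₂ _+_ (cong₂ _+_ (row+heavy i) (row+heavy i′)) (cong₂ _+_ (col+heavy j) (col+heavy j′)))
      pair-up : ∀ x₁ x₂ x₃ x₄ x₅ x₆ y₁ y₂ y₃ y₄ y₅ y₆ →
        (x₁ + x₂) + (x₃ + x₄) + (x₅ + x₆) + ((y₁ + y₂) + (y₃ + y₄) + (y₅ + y₆))
          ≡ ((x₁ + y₁) + (x₂ + y₂)) + ((x₃ + y₃) + (x₄ + y₄)) + ((x₅ + y₅) + (x₆ + y₆))
      pair-up = solve-∀
      complement : (s i j + s i j′) + (s i′ j + s i′ j′) + (s i j′ + s i′ j) + cells a a′ b b′ ≡ 6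
      complement = trans (pair-up (s i j) (s i j′) (s i′ j) (s i′ j′) (s i j′) (s i′ j) _ _ _ _ _ _)
                         (cong₂ _+_ (cong₂ _+_ (cong₂ _+_ (s+τ i j) (s+τ i j′)) (cong₂ _+_ (s+τ i′ j) (s+τ i′ j′)))
                                    (cong₂ _+_ (s+τ i j′) (s+τ i′ j)))

    resolving : IsWeakResolving G (2 * n ∸ 2 * t ∸ 1) S⋆
    resolving (i , j) (i′ , j′) x≢y with i ≟ i′ | j ≟ j′
    ... | yes refl | yes refl = case x≢y of λ ()
    ... | yes refl | no j≢j′  = Equivalence.from (bound⇔ _) (sameRow-separated i j≢j′)
    ... | no i≢i′  | yes refl = Equivalence.from (bound⇔ _) (sameCol-separated j i≢i′)
    ... | no i≢i′  | no j≢j′  = Equivalence.from (bound⇔ _) (adjacent-separated i≢i′ j≢j′)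

    optimal-set : Σ (Fin n × Fin n → Bool) λ S →
      IsWeakResolving G (2 * n ∸ 2 * t ∸ 1) S × card G S ≡ n * n ∸ t * n ∸ n / suc t
    optimal-set = S⋆ , resolving , card⋆

mainTheorem11 : (n t : ℕ) → 6 ≤ n → 1 ≤ t → t ≤ n ∸ 3 →
  WdimIs (KnxKn n) (2 * n ∸ 2 * t ∸ 1) (n * n ∸ t * n ∸ n / suc t)
mainTheorem11 .(3 + k) t 6≤n@(s≤s (s≤s (s≤s {n = k} _))) 1≤t t≤n∸3 =
  optimal-set k {t} n≡t+p 1≤t 3≤p 6≤n , card-lower-bound k {t} n≡t+p
  where
  n = 3 + k
  t+3≤n : t + 3 ≤ n
  t+3≤n = subst (t + 3 ≤_) (+-comm k 3) (+-monoˡ-≤ 3 t≤n∸3)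
  n≡t+p : n ≡ t + (n ∸ t)
  n≡t+p = sym (m+[n∸m]≡n (≤-trans (m≤m+n t 3) t+3≤n))
  3≤p : 3 ≤ n ∸ t
  3≤p = m+n≤o⇒m≤o∸n 3 (subst (_≤ n) (+-comm t 3) t+3≤n)
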